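{- Let $n=p_1^{n_1}\cdots p_r^{n_r}$ with $r\geq 3$, primes $p_1<\cdots<p_r$ and positive integers $n_i$; put $P=p_1\cdots p_r$. Let $a,b\in[r]$ with $a\neq b$, $s\in[n_a]$, $t\in[n_b]$. Then $|X_{a,b}^{s,t}|=\theta_{a,b}^{s,t}$, where $\theta_{a,b}^{s,t}=\phi(n)+\frac{n}{P}v$ with - if $s=n_a,t=n_b$: $v=\phi\left(\frac{P}{p_ap_b}\right)\left(1-\frac{2}{p_a^{n_a-1}p_b^{n_b-1}}\right)+\phi\left(\frac{P}{p_a}\right)+\phi\left(\frac{P}{p_b}\right)+\frac{P}{p_a^{n_a}p_b^{n_b}}$; - if $s=n_a,t<n_b$: $v=\phi\left(\frac{P}{p_ap_b}\right)\left(1-\frac{1}{p_b^t}\right)+\phi\left(\frac{P}{p_a}\right)\left(1-\frac{2}{p_a^{n_a-1}p_b^t}\right)+\phi\left(\frac{P}{p_b}\right)\left(1-\frac{1}{p_b^t}\right)+\frac{P}{p_a^{n_a}p_b^t}$; - if $s<n_a,t=n_b$: $v=\phi\left(\frac{P}{p_ap_b}\right)\left(1-\frac{1}{p_a^s}\right)+\phi\left(\frac{P}{p_a}\right)\left(1-\frac{1}{p_a^s}\right)+\phi\left(\frac{P}{p_b}\right)\left(1-\frac{2}{p_a^{s}p_b^{n_b-1}}\right)+\frac{P}{p_a^{s}p_b^{n_b}}$; - if $s<n_a,t<n_b$: $v=\phi\left(\frac{P}{p_ap_b}\right)\left(1-\frac{1}{p_a^s}\right)\left(1-\frac{1}{p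_b^t}\right)+\phi\left(\frac{P}{p_a}\right)\left(1-\frac{1}{p_a^s}\right)+\phi\left(\frac{P}{p_b}\right)\left(1-\frac{1}{p_b^t}\right)-\frac{2\phi(P)}{p_a^sp_b^t}+\frac{P}{p_a^sp_b^t}$.
   Context: $[m]=\{1,\dots,m\}$, $\phi$ is Euler's totient function, $C_n$ is the cyclic group of order $n$. For $d\mid n$, $E_d$ is the set of elements of order $d$ in $C_n$ and $S_d$ the subgroup of order $d$. For $a\neq b$ in $[r]$, $s\in[n_a]$, $t\in[n_b]$: $K_{a,b}^{s,t}$ is the set of non-generators of the cyclic subgroup $S_{n/(p_a^sp_b^t)}$; $H_{a,b}^{s,t}$ is the union of the sets $E_{n/(p_a^ip_b^j)}$ over $0\le i\le s$, $0\le j\le t$, $(i,j)\neq(s,t)$; and $X_{a,b}^{s,t}:=H_{a,b}^{s,t}\cup K_{a,b}^{s,t}$. -}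

module Defs where

open import Data.Bool using (Bool; true; false; if_then_else_; _∧_; not)
open import Data.Nat using (ℕ; zero; suc; _+_; _*_; _∸_; _^_; _≡ᵇ_)
open import Data.Nat.Divisibility using (_∣?_)
open import Data.Nat.GCD using (gcd)
import Data.Nat.DivMod as DM
open import Data.Fin using (Fin; toℕ)
import Data.Fin as F
open import Data.List using (List; length; filterᵇ; allFin; upTo)
open import Data.Bool.ListAction using (any)
open import Data.Integer using (+_)
open import Data.Rational using (ℚ; _/_; 1ℚ; 0ℚ) renaming (_+_ to _+q_; _*_ to _*q_; _-_ to _-q_)
open import Relation.Nullary.Decidable using (⌊_⌋)

-- total natural division; only ever used with a nonzero divisor (convention: m div 0 = 0)
_div_ : ℕ → ℕ → ℕ
m div zero = 0
m div (suc k) = DM._/_ m (suc k)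

prodF : (r : ℕ) → (Fin r → ℕ) → ℕ
prodF zero f = 1
prodF (suc r) f = f F.zero * prodF r (λ i → f (F.suc i))

phi : ℕ → ℕ
phi m = length (filterᵇ (λ k → gcd (suc k) m ≡ᵇ 1) (upTo m))

-- the cyclic group C_n is modelled as ℤ/nℤ = {0,…,n-1} under addition mod n.
-- order of x in C_n: least k ∈ [1..n] with n ∣ k·x.
ordSearch : ℕ → ℕ → ℕ → ℕ → ℕ
ordSearch n x zero k = 0
ordSearch n x (suc fuel) k =
  if ⌊ n ∣? (k * x) ⌋ then k else ordSearch n x fuel (suc k)

ord : (n : ℕ) → Fin n → ℕ
ord n x = ordSearch n (toℕ x) n 1

inE : (n d : ℕ) → Fin n → Bool
inE n d x = ord n x ≡ᵇ d

-- x ∈ S_d  (the subgroup of order d, d ∣ n: all elements with d·x = 0)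
inS : (n d : ℕ) → Fin n → Bool
inS n d x = ⌊ n ∣? (d * toℕ x) ⌋

inK : (n pa pb s t : ℕ) → Fin n → Bool
inK n pa pb s t x = let m = n div (pa ^ s * pb ^ t) in inS n m x ∧ not (inE n m x)

inH : (n pa pb s t : ℕ) → Fin n → Bool
inH n pa pb s t x =
  any (λ i → any (λ j → not ((i ≡ᵇ s) ∧ (j ≡ᵇ t)) ∧ inE n (n div (pa ^ i * pb ^ j)) x)
                 (upTo (suc t)))
      (upTo (suc s))

inX : (n pa pb s t : ℕ) → Fin n → Bool
inX n pa pb s t x = inH n pa pb s t x Data.Bool.∨ inK n pa pb s t x

cardX : (n pa pb s t : ℕ) → ℕ
cardX n pa pb s t = length (filterᵇ (inX n pa pb s t) (allFin n))

-- rationals: natural number embedding and fraction k/m (convention k/0 = 0; only used with m ≠ 0)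
ℚ[_] : ℕ → ℚ
ℚ[ k ] = + k / 1

frac : ℕ → ℕ → ℚ
frac k zero = 0ℚ
frac k (suc m) = + k / suc m

theta : (n P pa pb na nb s t : ℕ) → ℚ
theta n P pa pb na nb s t =
  ℚ[ phi n ] +q frac n P *q v
  where
  φab = ℚ[ phi (P div (pa * pb)) ]
  φa  = ℚ[ phi (P div pa) ]
  φb  = ℚ[ phi (P div pb) ]
  v : ℚ
  v = if s ≡ᵇ na then
        (if t ≡ᵇ nb then
           φab *q (1ℚ -q frac 2 (pa ^ (na ∸ 1) * pb ^ (nb ∸ 1))) +q φa +q φb
             +q frac P (pa ^ na * pb ^ nb)
         else
           φab *q (1ℚ -q frac 1 (pb ^ t)) +q φa *q (1ℚ -q frac 2 (pa ^ (na ∸ 1) * pb ^ t))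
             +q φb *q (1ℚ -q frac 1 (pb ^ t)) +q frac P (pa ^ na * pb ^ t))
      else
        (if t ≡ᵇ nb then
           φab *q (1ℚ -q frac 1 (pa ^ s)) +q φa *q (1ℚ -q frac 1 (pa ^ s))
             +q φb *q (1ℚ -q frac 2 (pa ^ s * pb ^ (nb ∸ 1))) +q frac P (pa ^ s * pb ^ nb)
         else
           (φab *q (1ℚ -q frac 1 (pa ^ s))) *q (1ℚ -q frac 1 (pb ^ t)) +q φa *q (1ℚ -q frac 1 (pa ^ s))
             +q φb *q (1ℚ -q frac 1 (pb ^ t)) -q frac (2 * phi P) (pa ^ s * pb ^ t)
             +q frac P (pa ^ s * pb ^ t))

-- In ℤ/n the element k has order n / gcd(k, n), so the elements of order n/d are those with
-- gcd(k, n) = d (there are φ(n/d) of them), and the subgroup of order n/d is the set of multiples of d.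
-- Write n = A^x B^y R with A = p_a, B = p_b and R coprime to AB. Then H is the disjoint union of the
-- level sets gcd(k, n) = A^i B^j over i ≤ s, j ≤ t, (i, j) ≠ (s, t); K consists of the multiples of
-- A^s B^t outside the level set of A^s B^t; and H ∩ K = ∅, since no such A^i B^j is divisible by A^s B^t.
-- With D = A^(x-s) B^(y-t) R this gives |X| + 2φ(D) = Σ_{i ≤ s, j ≤ t} φ(A^(x-i) B^(y-j) R) + D, where
-- the double sum factorises and each factor telescopes, as φ(A^(w+1)) + A^w = A^(w+1). The result is a
-- polynomial in A^s, A^(x-1-s), B^t, B^(y-1-t), Q, R/Q and φ(Q), where Q is the product of the other
-- primes; the four formulas for θ agree with it after clearing the denominators A^s (or A^(x-1)) and
-- B^t (or B^(y-1)).
module Submission where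

open import Defs
open import Algebra.Properties.CommutativeSemigroup using (interchange)
open import Data.Bool using (Bool; true; false; _∧_; _∨_; not; T; if_then_else_)
open import Data.Bool.ListAction using (any)
open import Data.Bool.Properties using (∧-identityʳ; ∧-zeroʳ; T-≡)
open import Data.Empty using (⊥)
open import Data.Fin using (Fin; toℕ)
import Data.Fin as Fin
import Data.Fin.Properties as Finₚ
import Data.Integer.Base as ℤ
import Data.Integer.Properties as ℤ
open import Data.List using ([]; _∷_; length; filterᵇ; applyUpTo; tabulate; upTo)
open import Data.List.Relation.Unary.Any.Properties using (any⁻; applyUpTo⁻)
open import Data.Nat
import Data.Nat
open import Data.Nat.Coprimality as Coprimality using (Coprime; coprime?; coprime-divisor)
open import Data.Nat.DivMod using (m*n/n≡m)
open import Data.Nat.Divisibility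
open import Data.Nat.GCD
open import Data.Nat.Primality using (Prime; prime⇒nonZero; prime⇒nonTrivial; prime⇒irreducible; euclidsLemma)
open import Data.Nat.Properties
open import Data.Nat.Tactic.RingSolver using (solve-∀)
open import Data.Product using (∃; _×_; _,_; proj₁; proj₂)
open import Data.Rational.Base using (ℚ; 0ℚ; 1ℚ; toℚᵘ) renaming (_+_ to _+q_; _*_ to _*q_; _-_ to _-q_)
import Data.Rational.Base as ℚ
import Data.Rational.Properties as ℚ
open import Data.Rational.Unnormalised.Base using (mkℚᵘ; *≡*) renaming (_≃_ to _≃ᵘ_)
import Data.Rational.Unnormalised.Properties as ℚᵘ
open import Data.Sum using (_⊎_; inj₁; inj₂; [_,_])
open import Function using (_∘_; _⇔_; mk⇔)
open import Function.Bundles using (module Equivalence)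
open import Level using (0ℓ)
open import Relation.Binary.Definitions using (tri<; tri≈; tri>)
open import Relation.Binary.PropositionalEquality using (_≡_; _≢_; refl; sym; trans; cong; cong₂; subst; subst₂; module ≡-Reasoning)
open import Relation.Nullary using (¬_; Dec; yes; no; does; contradiction)
open import Relation.Nullary.Decidable using (⌊_⌋; dec-true; dec-false; does-⇔; isYes≗does; dec⇒maybe)
import Tactic.RingSolver as Ring
open import Tactic.RingSolver.Core.AlmostCommutativeRing using (AlmostCommutativeRing; fromCommutativeRing)

-- Counting

indicator : Bool → ℕ
indicator true  = 1
indicator false = 0

∧≡true⇒ : ∀ a b → a ∧ b ≡ true → a ≡ true × b ≡ true
∧≡true⇒ true true _ = refl , refl

≡ᵇ-true⇒ : ∀ {m n} → (m ≡ᵇ n) ≡ true → m ≡ n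
≡ᵇ-true⇒ {m} {n} eq = ≡ᵇ⇒≡ m n (subst T (sym eq) _)

≡ᵇ-refl : ∀ n → (n ≡ᵇ n) ≡ true
≡ᵇ-refl zero    = refl
≡ᵇ-refl (suc n) = ≡ᵇ-refl n

count : (ℕ → Bool) → ℕ → ℕ
count f zero    = 0
count f (suc N) = indicator (f 0) + count (f ∘ suc) N

module _ {A : Set} where

  length-filterᵇ-∷ : ∀ (p : A → Bool) x xs →
    length (filterᵇ p (x ∷ xs)) ≡ indicator (p x) + length (filterᵇ p xs)
  length-filterᵇ-∷ p x xs with p x
  ... | true  = refl
  ... | false = refl

  length-filterᵇ-applyUpTo : ∀ (p : A → Bool) (g : ℕ → A) N →
    length (filterᵇ p (applyUpTo g N)) ≡ count (p ∘ g) N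
  length-filterᵇ-applyUpTo p g zero    = refl
  length-filterᵇ-applyUpTo p g (suc N) =
    trans (length-filterᵇ-∷ p (g 0) _) (cong (indicator (p (g 0)) +_) (length-filterᵇ-applyUpTo p (g ∘ suc) N))

  length-filterᵇ-tabulate : ∀ {N} (p : A → Bool) (g : Fin N → A) (f : ℕ → Bool) →
    (∀ i → p (g i) ≡ f (toℕ i)) → length (filterᵇ p (tabulate g)) ≡ count f N
  length-filterᵇ-tabulate {zero}  p g f pg≗f = refl
  length-filterᵇ-tabulate {suc N} p g f pg≗f =
    trans (length-filterᵇ-∷ p (g Fin.zero) _)
          (cong₂ _+_ (cong indicator (pg≗f Fin.zero))
                     (length-filterᵇ-tabulate p (g ∘ Fin.suc) (f ∘ suc) (pg≗f ∘ Fin.suc)))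


  any-false : ∀ (p : A → Bool) (g : ℕ → A) m → (∀ i → i < m → p (g i) ≡ false) → any p (applyUpTo g m) ≡ false
  any-false p g zero    all-false = refl
  any-false p g (suc m) all-false rewrite all-false 0 z<s =
    any-false p (g ∘ suc) m (λ i i<m → all-false (suc i) (s<s i<m))

  any-true⇒ : ∀ (p : A → Bool) (g : ℕ → A) m → any p (applyUpTo g m) ≡ true → ∃ λ i → i < m × p (g i) ≡ true
  any-true⇒ p g m any≡true =
    let i , i<m , pgi = applyUpTo⁻ g (any⁻ p _ (Equivalence.from T-≡ any≡true)) in
    i , i<m , Equivalence.to T-≡ pgi

count-cong : ∀ {f g} N → (∀ k → k < N → f k ≡ g k) → count f N ≡ count g N
count-cong zero    f≗g = refl
count-cong (suc N) f≗g =
  cong₂ _+_ (cong indicator (f≗g 0 z<s)) (count-cong N (λ k k<N → f≗g (suc k) (s<s k<N)))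

count-none : ∀ {f} N → (∀ k → k < N → f k ≡ false) → count f N ≡ 0
count-none zero    f≡false = refl
count-none (suc N) f≡false rewrite f≡false 0 z<s = count-none N (λ k k<N → f≡false (suc k) (s<s k<N))

count-all : ∀ N → count (λ _ → true) N ≡ N
count-all zero    = refl
count-all (suc N) = cong suc (count-all N)

count-+ : ∀ f M N → count f (M + N) ≡ count f M + count (λ k → f (M + k)) N
count-+ f zero    N = refl
count-+ f (suc M) N =
  trans (cong (indicator (f 0) +_) (count-+ (f ∘ suc) M N)) (sym (+-assoc (indicator (f 0)) _ _))

count-last : ∀ f N → count f (suc N) ≡ count f N + indicator (f N)
count-last f N = begin
  count f (suc N)                                ≡⟨ cong (count f) (+-comm 1 N) ⟩
  count f (N + 1)                                ≡⟨ count-+ f N 1 ⟩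
  count f N + (indicator (f (N + 0)) + 0)        ≡⟨ cong (λ m → count f N + (indicator (f m) + 0)) (+-identityʳ N) ⟩
  count f N + (indicator (f N) + 0)              ≡⟨ cong (count f N +_) (+-identityʳ _) ⟩
  count f N + indicator (f N)                    ∎
  where open ≡-Reasoning

count-∨ : ∀ f g N → (∀ k → k < N → f k ≡ true → g k ≡ false) →
  count (λ k → f k ∨ g k) N ≡ count f N + count g N
count-∨ f g zero    disjoint = refl
count-∨ f g (suc N) disjoint =
  trans (cong₂ _+_ (head (f 0) (g 0) (disjoint 0 z<s))
                   (count-∨ (f ∘ suc) (g ∘ suc) N (λ k k<N → disjoint (suc k) (s<s k<N))))
        (interchange +-commutativeSemigroup (indicator (f 0)) (indicator (g 0)) _ _)
  where
  head : ∀ a b → (a ≡ true → b ≡ false) → indicator (a ∨ b) ≡ indicator a + indicator b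
  head true  b a⇒¬b rewrite a⇒¬b refl = refl
  head false b a⇒¬b = refl

count-partition : ∀ f g N → count f N ≡ count (λ k → f k ∧ g k) N + count (λ k → f k ∧ not (g k)) N
count-partition f g zero    = refl
count-partition f g (suc N) =
  trans (cong₂ _+_ (head (f 0) (g 0)) (count-partition (f ∘ suc) (g ∘ suc) N))
        (interchange +-commutativeSemigroup (indicator (f 0 ∧ g 0)) (indicator (f 0 ∧ not (g 0))) _ _)
  where
  head : ∀ a b → indicator a ≡ indicator (a ∧ b) + indicator (a ∧ not b)
  head true  true  = refl
  head true  false = refl
  head false b     = refl

count-∧ˡ : ∀ b f N → count (λ k → b ∧ f k) N ≡ indicator b * count f N
count-∧ˡ true  f N = sym (+-identityʳ (count f N))
count-∧ˡ false f N = count-none N (λ _ _ → refl)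

count-periodic : ∀ f Q → (∀ k → f (Q + k) ≡ f k) → ∀ L → count f (L * Q) ≡ L * count f Q
count-periodic f Q periodic zero    = refl
count-periodic f Q periodic (suc L) =
  trans (count-+ f Q (L * Q))
        (cong (count f Q +_) (trans (count-cong (L * Q) (λ k _ → periodic k)) (count-periodic f Q periodic L)))

count-multiples : ∀ E .{{_ : NonZero E}} (f : ℕ → Bool) D →
  count (λ k → f k ∧ does (E ∣? k)) (D * E) ≡ count (λ j → f (j * E)) D
count-multiples E@(suc E-1) f zero    = refl
count-multiples E@(suc E-1) f (suc D) = begin
  count h (E + D * E)                                  ≡⟨ count-+ h E (D * E) ⟩
  count h E + count (λ k → h (E + k)) (D * E)          ≡⟨ cong₂ _+_ first-block shifted ⟩
  indicator (f 0) + count (λ j → f (E + j * E)) D      ∎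
  where
  open ≡-Reasoning
  h : ℕ → Bool
  h k = f k ∧ does (E ∣? k)
  first-block : count h E ≡ indicator (f 0)
  first-block = begin
    indicator (f 0 ∧ does (E ∣? 0)) + count (h ∘ suc) E-1
      ≡⟨ cong₂ (λ b c → indicator (f 0 ∧ b) + c) (dec-true (E ∣? 0) (E ∣0)) rest-empty ⟩
    indicator (f 0 ∧ true) + 0
      ≡⟨ cong (λ b → indicator b + 0) (∧-identityʳ (f 0)) ⟩
    indicator (f 0) + 0
      ≡⟨ +-identityʳ _ ⟩
    indicator (f 0) ∎
    where
    rest-empty : count (h ∘ suc) E-1 ≡ 0
    rest-empty = count-none E-1 λ k k<E-1 →
      trans (cong (f (suc k) ∧_) (dec-false (E ∣? suc k) (λ E∣ → <⇒≱ (s<s k<E-1) (∣⇒≤ E∣)))) (∧-zeroʳ (f (suc k)))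
  shifted : count (λ k → h (E + k)) (D * E) ≡ count (λ j → f (E + j * E)) D
  shifted = trans
    (count-cong (D * E) λ k _ → cong (f (E + k) ∧_) (does-⇔ E∣E+k⇔E∣k (E ∣? (E + k)) (E ∣? k)))
    (count-multiples E (λ k → f (E + k)) D)
    where
    E∣E+k⇔E∣k : ∀ {k} → E ∣ E + k ⇔ E ∣ k
    E∣E+k⇔E∣k = mk⇔ (λ E∣E+k → ∣m+n∣m⇒∣n E∣E+k ∣-refl) (∣m∣n⇒∣m+n ∣-refl)

∑< : ℕ → (ℕ → ℕ) → ℕ
∑< zero    f = 0
∑< (suc m) f = f 0 + ∑< m (f ∘ suc)

syntax ∑< m (λ i → e) = ∑[ i < m ] e

∑-cong : ∀ {f g} m → (∀ i → i < m → f i ≡ g i) → ∑< m f ≡ ∑< m g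
∑-cong zero    f≗g = refl
∑-cong (suc m) f≗g = cong₂ _+_ (f≗g 0 z<s) (∑-cong m (λ i i<m → f≗g (suc i) (s<s i<m)))

∑-last : ∀ f m → ∑< (suc m) f ≡ ∑< m f + f m
∑-last f zero    = +-comm (f 0) 0
∑-last f (suc m) = trans (cong (f 0 +_) (∑-last (f ∘ suc) m)) (sym (+-assoc (f 0) _ _))

∑-*ˡ : ∀ c f m → ∑[ i < m ] (c * f i) ≡ c * ∑< m f
∑-*ˡ c f zero    = sym (*-zeroʳ c)
∑-*ˡ c f (suc m) = trans (cong (c * f 0 +_) (∑-*ˡ c (f ∘ suc) m)) (sym (*-distribˡ-+ c (f 0) _))

∑-*ʳ : ∀ c f m → ∑[ i < m ] (f i * c) ≡ ∑< m f * c
∑-*ʳ c f m = trans (∑-cong m (λ i _ → *-comm (f i) c)) (trans (∑-*ˡ c f m) (*-comm c _))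

count-any : ∀ (f : ℕ → ℕ → Bool) (g : ℕ → ℕ) m N →
  (∀ i j k → i < m → j < m → f (g i) k ≡ true → f (g j) k ≡ true → i ≡ j) →
  count (λ k → any (λ i → f i k) (applyUpTo g m)) N ≡ ∑[ i < m ] count (f (g i)) N
count-any f g zero    N disjoint = count-none N (λ _ _ → refl)
count-any f g (suc m) N disjoint =
  trans (count-∨ (f (g 0)) (λ k → any (λ i → f i k) (applyUpTo (g ∘ suc) m)) N
                 (λ k _ f₀k → any-false (λ i → f i k) (g ∘ suc) m (λ i i<m → rest-false k f₀k i i<m)))
        (cong (count (f (g 0)) N +_)
              (count-any f (g ∘ suc) m N (λ i j k i<m j<m fi fj → suc-injective (disjoint (suc i) (suc j) k (s<s i<m) (s<s j<m) fi fj))))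
  where
  rest-false : ∀ k → f (g 0) k ≡ true → ∀ i → i < m → f (g (suc i)) k ≡ false
  rest-false k f₀k i i<m with f (g (suc i)) k in fᵢk
  ... | false = refl
  ... | true  with () ← disjoint 0 (suc i) k z<s (s<s i<m) f₀k fᵢk

∑∑-except-corner : ∀ (f : ℕ → ℕ → ℕ) s t →
  ∑[ i < suc s ] ∑[ j < suc t ] (indicator (not ((i ≡ᵇ s) ∧ (j ≡ᵇ t))) * f i j) + f s t
    ≡ ∑[ i < suc s ] ∑[ j < suc t ] f i j
∑∑-except-corner f s t = begin
  ∑< (suc s) row′ + f s t
    ≡⟨ cong (_+ f s t) (∑-last row′ s) ⟩
  ∑< s row′ + row′ s + f s t
    ≡⟨ cong (λ m → m + row′ s + f s t) (∑-cong s (λ i i<s → ∑-cong (suc t) (λ j _ → keep i j (inj₁ i<s)))) ⟩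
  ∑< s row + row′ s + f s t
    ≡⟨ +-assoc (∑< s row) (row′ s) (f s t) ⟩
  ∑< s row + (row′ s + f s t)
    ≡⟨ cong (∑< s row +_) last-row ⟩
  ∑< s row + row s
    ≡⟨ ∑-last row s ⟨
  ∑< (suc s) row ∎
  where
  open ≡-Reasoning
  w : ℕ → ℕ → Bool
  w i j = not ((i ≡ᵇ s) ∧ (j ≡ᵇ t))
  row row′ : ℕ → ℕ
  row  i = ∑[ j < suc t ] f i j
  row′ i = ∑[ j < suc t ] (indicator (w i j) * f i j)
  keep : ∀ i j → i < s ⊎ (i ≡ s × j < t) → indicator (w i j) * f i j ≡ f i j
  keep i j off-corner with i ≡ᵇ s in i≡ᵇs | j ≡ᵇ t in j≡ᵇt
  ... | false | _     = +-identityʳ (f i j)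
  ... | true  | false = +-identityʳ (f i j)
  ... | true  | true  with off-corner
  ...   | inj₁ i<s         = contradiction (≡ᵇ-true⇒ i≡ᵇs) (<⇒≢ i<s)
  ...   | inj₂ (_ , j<t)   = contradiction (≡ᵇ-true⇒ j≡ᵇt) (<⇒≢ j<t)
  corner : w s t ≡ false
  corner rewrite ≡ᵇ-refl s | ≡ᵇ-refl t = refl
  last-row : row′ s + f s t ≡ row s
  last-row = begin
    row′ s + f s t
      ≡⟨ cong (_+ f s t) (∑-last (λ j → indicator (w s j) * f s j) t) ⟩
    ∑[ j < t ] (indicator (w s j) * f s j) + indicator (w s t) * f s t + f s t
      ≡⟨ cong₂ (λ m b → m + indicator b * f s t + f s t) (∑-cong t (λ j j<t → keep s j (inj₂ (refl , j<t)))) corner ⟩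
    ∑[ j < t ] f s j + 0 + f s t
      ≡⟨ cong (_+ f s t) (+-identityʳ _) ⟩
    ∑[ j < t ] f s j + f s t
      ≡⟨ ∑-last (f s) t ⟨
    row s ∎

-- Coprimality and divisibility by primes

coprime-*⁻ˡ : ∀ {k m n} → Coprime k (m * n) → Coprime k m
coprime-*⁻ˡ {n = n} k⊥mn (d∣k , d∣m) = k⊥mn (d∣k , ∣m⇒∣m*n n d∣m)

coprime-*⁻ʳ : ∀ {k m n} → Coprime k (m * n) → Coprime k n
coprime-*⁻ʳ {m = m} k⊥mn (d∣k , d∣n) = k⊥mn (d∣k , ∣n⇒∣m*n m d∣n)

coprime-* : ∀ {k m n} → Coprime k m → Coprime k n → Coprime k (m * n)
coprime-* k⊥m k⊥n (d∣k , d∣mn) = k⊥n (d∣k , coprime-divisor (λ (e∣d , e∣m) → k⊥m (∣-trans e∣d d∣k , e∣m)) d∣mn)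

coprime-^ : ∀ {k m} u → Coprime k m → Coprime k (m ^ u)
coprime-^ zero    k⊥m (_ , d∣1) = ∣1⇒≡1 d∣1
coprime-^ (suc u) k⊥m = coprime-* k⊥m (coprime-^ u k⊥m)

module _ {p : ℕ} (p-prime : Prime p) where
  private instance _ = prime⇒nonZero p-prime

  ∤⇒coprime : ∀ {k} → ¬ p ∣ k → Coprime k p
  ∤⇒coprime p∤k (d∣k , d∣p) with prime⇒irreducible p-prime d∣p
  ... | inj₁ d≡1 = d≡1
  ... | inj₂ refl = contradiction d∣k p∤k

  coprime⇒∤ : ∀ {k} → Coprime k p → ¬ p ∣ k
  coprime⇒∤ k⊥p p∣k = nonTrivial⇒≢1 {{prime⇒nonTrivial p-prime}} (k⊥p (p∣k , ∣-refl))

  ∤1 : ¬ p ∣ 1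
  ∤1 p∣1 = nonTrivial⇒≢1 {{prime⇒nonTrivial p-prime}} (∣1⇒≡1 p∣1)

  ∤-* : ∀ {m n} → ¬ p ∣ m → ¬ p ∣ n → ¬ p ∣ m * n
  ∤-* {m} {n} p∤m p∤n p∣mn with euclidsLemma m n p-prime p∣mn
  ... | inj₁ p∣m = p∤m p∣m
  ... | inj₂ p∣n = p∤n p∣n

  ∤-^ : ∀ {m} u → ¬ p ∣ m → ¬ p ∣ m ^ u
  ∤-^ zero    p∤m = ∤1
  ∤-^ (suc u) p∤m = ∤-* p∤m (∤-^ u p∤m)

  ∤-prime : ∀ {q} → Prime q → p ≢ q → ¬ p ∣ q
  ∤-prime q-prime p≢q p∣q with prime⇒irreducible q-prime p∣q
  ... | inj₁ p≡1 = ∤1 (∣-reflexive p≡1)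
  ... | inj₂ p≡q = p≢q p≡q

  ^-*-injective : ∀ i i' {X Y} → ¬ p ∣ X → ¬ p ∣ Y → p ^ i * X ≡ p ^ i' * Y → i ≡ i'
  ^-*-injective zero    zero     p∤X p∤Y eq = refl
  ^-*-injective zero    (suc i') {X} {Y} p∤X p∤Y eq =
    contradiction (divides (p ^ i' * Y) (trans (sym (*-identityˡ X)) (trans eq (trans (*-assoc p _ Y) (*-comm p _))))) p∤X
  ^-*-injective (suc i) zero     {X} {Y} p∤X p∤Y eq =
    contradiction (divides (p ^ i * X) (trans (sym (*-identityˡ Y)) (trans (sym eq) (trans (*-assoc p _ X) (*-comm p _))))) p∤Y
  ^-*-injective (suc i) (suc i') {X} {Y} p∤X p∤Y eq =
    cong suc (^-*-injective i i' p∤X p∤Y (*-cancelˡ-≡ _ _ p (trans (sym (*-assoc p _ X)) (trans eq (*-assoc p _ Y)))))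

  ^∤^-* : ∀ {i s X} → i < s → ¬ p ∣ X → ¬ p ^ s ∣ p ^ i * X
  ^∤^-* {zero}  {suc s} {X} _         p∤X pˢ∣X  =
    p∤X (∣-trans (divides (p ^ s) (*-comm p _)) (∣-trans pˢ∣X (∣-reflexive (*-identityˡ X))))
  ^∤^-* {suc i} {suc s} {X} (s<s i<s) p∤X pˢ∣pⁱX =
    ^∤^-* i<s p∤X (*-cancelˡ-∣ p (subst (p * p ^ s ∣_) (*-assoc p _ X) pˢ∣pⁱX))

module _ {A B : ℕ} (A-prime : Prime A) (B-prime : Prime B) (A≢B : A ≢ B) where
  private instance _ = prime⇒nonZero A-prime

  ^-*-^-injective : ∀ i j i' j' → A ^ i * B ^ j ≡ A ^ i' * B ^ j' → i ≡ i' × j ≡ j'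
  ^-*-^-injective i j i' j' eq = i≡i' , j≡j'
    where
    A∤B : ¬ A ∣ B
    A∤B = ∤-prime A-prime B-prime A≢B
    i≡i' : i ≡ i'
    i≡i' = ^-*-injective A-prime i i' (∤-^ A-prime j A∤B) (∤-^ A-prime j' A∤B) eq
    j≡j' : j ≡ j'
    j≡j' = ^-*-injective B-prime j j' (∤1 B-prime) (∤1 B-prime)
             (trans (*-identityʳ _) (trans (*-cancelˡ-≡ _ _ (A ^ i) {{m^n≢0 A i}} (trans eq (cong (λ e → A ^ e * B ^ j') (sym i≡i'))))
                                           (sym (*-identityʳ _))))

-- Euler's totient

phi-count : ∀ M → phi M ≡ count (λ k → does (coprime? k M)) M
phi-count M = +-cancelˡ-≡ (indicator (coprimeTo 0)) _ _ (begin
  indicator (coprimeTo 0) + phi M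
    ≡⟨ cong (indicator (coprimeTo 0) +_) (length-filterᵇ-applyUpTo (coprimeTo ∘ suc) (λ k → k) M) ⟩
  count coprimeTo (suc M)
    ≡⟨ count-last coprimeTo M ⟩
  count coprimeTo M + indicator (coprimeTo M)
    ≡⟨ cong (λ b → count coprimeTo M + indicator b) M⊥M⇔0⊥M ⟩
  count coprimeTo M + indicator (coprimeTo 0)
    ≡⟨ +-comm _ (indicator (coprimeTo 0)) ⟩
  indicator (coprimeTo 0) + count coprimeTo M ∎)
  where
  open ≡-Reasoning
  coprimeTo : ℕ → Bool
  coprimeTo k = does (coprime? k M)
  M⊥M⇔0⊥M : coprimeTo M ≡ coprimeTo 0
  M⊥M⇔0⊥M = does-⇔ (mk⇔ M⊥M⇒0⊥M 0⊥M⇒M⊥M) (coprime? M M) (coprime? 0 M)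
    where
    M⊥M⇒0⊥M : Coprime M M → Coprime 0 M
    M⊥M⇒0⊥M M⊥M (_ , d∣M) = M⊥M (d∣M , d∣M)
    0⊥M⇒M⊥M : Coprime 0 M → Coprime M M
    0⊥M⇒M⊥M 0⊥M (d∣M , _) = 0⊥M (_ ∣0 , d∣M)

count-coprime : ∀ M L → count (λ k → does (coprime? k M)) (L * M) ≡ L * phi M
count-coprime M L = begin
  count (λ k → does (coprime? k M)) (L * M)   ≡⟨ count-periodic _ M shift L ⟩
  L * count (λ k → does (coprime? k M)) M     ≡⟨ cong (L *_) (phi-count M) ⟨
  L * phi M                                   ∎
  where
  open ≡-Reasoning
  shift : ∀ k → does (coprime? (M + k) M) ≡ does (coprime? k M)
  shift k = does-⇔ (mk⇔ M+k⊥M⇒k⊥M Coprimality.coprime-+) (coprime? (M + k) M) (coprime? k M)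
    where
    M+k⊥M⇒k⊥M : Coprime (M + k) M → Coprime k M
    M+k⊥M⇒k⊥M M+k⊥M (d∣k , d∣M) = M+k⊥M (∣m∣n⇒∣m+n d∣M d∣k , d∣M)

-- The hypothesis says that every prime factor of L divides M.
phi-*-sameRadical : ∀ L M → (∀ {k} → Coprime k M → Coprime k L) → phi (L * M) ≡ L * phi M
phi-*-sameRadical L M rad = begin
  phi (L * M)                                      ≡⟨ phi-count (L * M) ⟩
  count (λ k → does (coprime? k (L * M))) (L * M)  ≡⟨ count-cong (L * M) (λ k _ → does-⇔ ⊥LM⇔⊥M (coprime? k (L * M)) (coprime? k M)) ⟩
  count (λ k → does (coprime? k M)) (L * M)        ≡⟨ count-coprime M L ⟩
  L * phi M                                        ∎
  where
  open ≡-Reasoning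
  ⊥LM⇔⊥M : ∀ {k} → Coprime k (L * M) ⇔ Coprime k M
  ⊥LM⇔⊥M = mk⇔ (coprime-*⁻ʳ {m = L}) (λ k⊥M → coprime-* (rad k⊥M) k⊥M)

-- Among the A·M residues coprime to M, those divisible by the prime A are A-multiples of the
-- residues coprime to M; the others are exactly the residues coprime to A·M.
phi-prime-* : ∀ {A} M → Prime A → ¬ A ∣ M → phi (A * M) ≡ (A ∸ 1) * phi M
phi-prime-* {A} M A-prime A∤M = +-cancelʳ-≡ (phi M) _ _ (begin
  phi (A * M) + phi M                              ≡⟨ +-comm (phi (A * M)) (phi M) ⟩
  phi M + phi (A * M)                              ≡⟨ cong₂ _+_ multiples-of-A others ⟨
  count (λ k → ⊥M k ∧ A∣ k) (A * M) + count (λ k → ⊥M k ∧ not (A∣ k)) (A * M) ≡⟨ count-partition ⊥M A∣ (A * M) ⟨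
  count ⊥M (A * M)                                 ≡⟨ count-coprime M A ⟩
  A * phi M                                        ≡⟨ cong (_* phi M) (m∸n+n≡m {A} {1} A≥1) ⟨
  (A ∸ 1 + 1) * phi M                              ≡⟨ *-distribʳ-+ (phi M) (A ∸ 1) 1 ⟩
  (A ∸ 1) * phi M + 1 * phi M                      ≡⟨ cong ((A ∸ 1) * phi M +_) (*-identityˡ (phi M)) ⟩
  (A ∸ 1) * phi M + phi M                          ∎)
  where
  open ≡-Reasoning
  instance _ = prime⇒nonZero A-prime
  A≥1 : A ≥ 1
  A≥1 = >-nonZero⁻¹ A
  ⊥M A∣ : ℕ → Bool
  ⊥M k = does (coprime? k M)
  A∣ k = does (A ∣? k)
  multiples-of-A : count (λ k → ⊥M k ∧ A∣ k) (A * M) ≡ phi M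
  multiples-of-A = begin
    count (λ k → ⊥M k ∧ A∣ k) (A * M)  ≡⟨ cong (count (λ k → ⊥M k ∧ A∣ k)) (*-comm A M) ⟩
    count (λ k → ⊥M k ∧ A∣ k) (M * A)  ≡⟨ count-multiples A ⊥M M ⟩
    count (λ j → ⊥M (j * A)) M         ≡⟨ count-cong M (λ j _ → does-⇔ jA⊥M⇔j⊥M (coprime? (j * A) M) (coprime? j M)) ⟩
    count ⊥M M                         ≡⟨ phi-count M ⟨
    phi M                              ∎
    where
    jA⊥M⇔j⊥M : ∀ {j} → Coprime (j * A) M ⇔ Coprime j M
    jA⊥M⇔j⊥M {j} = mk⇔ jA⊥M⇒j⊥M (λ j⊥M → Coprimality.sym (coprime-* (Coprimality.sym j⊥M) (∤⇒coprime A-prime A∤M)))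
      where
      jA⊥M⇒j⊥M : Coprime (j * A) M → Coprime j M
      jA⊥M⇒j⊥M jA⊥M (d∣j , d∣M) = jA⊥M (∣m⇒∣m*n A d∣j , d∣M)
  others : count (λ k → ⊥M k ∧ not (A∣ k)) (A * M) ≡ phi (A * M)
  others = sym (trans (phi-count (A * M)) (count-cong (A * M) λ k _ → by-cases k (A ∣? k)))
    where
    by-cases : ∀ k → Dec (A ∣ k) → does (coprime? k (A * M)) ≡ (⊥M k ∧ not (A∣ k))
    by-cases k (yes A∣k) = trans (dec-false (coprime? k (A * M)) λ k⊥AM → coprime⇒∤ A-prime (coprime-*⁻ˡ k⊥AM) A∣k)
                                 (sym (trans (cong (λ b → ⊥M k ∧ not b) (dec-true (A ∣? k) A∣k)) (∧-zeroʳ (⊥M k))))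
    by-cases k (no A∤k)  = trans (does-⇔ (mk⇔ (coprime-*⁻ʳ {m = A}) (coprime-* (∤⇒coprime A-prime A∤k))) (coprime? k (A * M)) (coprime? k M))
                                 (sym (trans (cong (λ b → ⊥M k ∧ not b) (dec-false (A ∣? k) A∤k)) (∧-identityʳ (⊥M k))))

phi-prime^suc : ∀ {A} u → Prime A → phi (A ^ suc u) ≡ A ^ u * (A ∸ 1)
phi-prime^suc {A} u A-prime = begin
  phi (A ^ suc u)            ≡⟨ cong phi (*-comm A (A ^ u)) ⟩
  phi (A ^ u * A)            ≡⟨ phi-*-sameRadical (A ^ u) A (coprime-^ u) ⟩
  A ^ u * phi A              ≡⟨ cong (λ m → A ^ u * phi m) (*-identityʳ A) ⟨
  A ^ u * phi (A * 1)        ≡⟨ cong (A ^ u *_) (phi-prime-* 1 A-prime (∤1 A-prime)) ⟩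
  A ^ u * ((A ∸ 1) * 1)      ≡⟨ cong (A ^ u *_) (*-identityʳ (A ∸ 1)) ⟩
  A ^ u * (A ∸ 1)            ∎
  where open ≡-Reasoning

phi-prime^-* : ∀ {A} u M → Prime A → ¬ A ∣ M → phi (A ^ u * M) ≡ phi (A ^ u) * phi M
phi-prime^-* zero M A-prime A∤M = trans (cong phi (+-identityʳ M)) (sym (+-identityʳ (phi M)))
phi-prime^-* {A} (suc u) M A-prime A∤M = begin
  phi (A ^ suc u * M)         ≡⟨ cong phi (rearrange A (A ^ u) M) ⟩
  phi (A ^ u * (A * M))       ≡⟨ phi-*-sameRadical (A ^ u) (A * M) (coprime-^ u ∘ coprime-*⁻ˡ) ⟩
  A ^ u * phi (A * M)         ≡⟨ cong (A ^ u *_) (phi-prime-* M A-prime A∤M) ⟩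
  A ^ u * ((A ∸ 1) * phi M)   ≡⟨ *-assoc (A ^ u) (A ∸ 1) (phi M) ⟨
  A ^ u * (A ∸ 1) * phi M     ≡⟨ cong (_* phi M) (phi-prime^suc u A-prime) ⟨
  phi (A ^ suc u) * phi M     ∎
  where
  open ≡-Reasoning
  rearrange : ∀ a b m → a * b * m ≡ b * (a * m)
  rearrange = solve-∀

∸≡suc∸suc : ∀ {x k} → k < x → x ∸ k ≡ suc (x ∸ suc k)
∸≡suc∸suc {suc x} {zero}  _         = refl
∸≡suc∸suc {suc x} {suc k} (s<s k<x) = ∸≡suc∸suc k<x

-- φ(A^x) + φ(A^(x-1)) + ⋯ telescopes because φ(A^(w+1)) + A^w = A^(w+1).
∑-phi-prime^ : ∀ {A} → Prime A → ∀ {x} k → k ≤ x → ∑[ i < k ] phi (A ^ (x ∸ i)) + A ^ (x ∸ k) ≡ A ^ x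
∑-phi-prime^ {A} A-prime {x} zero    _   = refl
∑-phi-prime^ {A} A-prime {x} (suc k) k<x = begin
  ∑< (suc k) f + A ^ w                     ≡⟨ cong (_+ A ^ w) (∑-last f k) ⟩
  ∑< k f + f k + A ^ w                     ≡⟨ +-assoc (∑< k f) (f k) (A ^ w) ⟩
  ∑< k f + (f k + A ^ w)                   ≡⟨ cong (λ e → ∑< k f + (phi (A ^ e) + A ^ w)) x∸k≡1+w ⟩
  ∑< k f + (phi (A ^ suc w) + A ^ w)       ≡⟨ cong (λ m → ∑< k f + (m + A ^ w)) (phi-prime^suc w A-prime) ⟩
  ∑< k f + (A ^ w * (A ∸ 1) + A ^ w)       ≡⟨ cong (∑< k f +_) (+-comm (A ^ w * (A ∸ 1)) (A ^ w)) ⟩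
  ∑< k f + (A ^ w + A ^ w * (A ∸ 1))       ≡⟨ cong (∑< k f +_) (*-suc (A ^ w) (A ∸ 1)) ⟨
  ∑< k f + A ^ w * suc (A ∸ 1)             ≡⟨ cong (λ m → ∑< k f + A ^ w * m) (suc-pred A) ⟩
  ∑< k f + A ^ w * A                       ≡⟨ cong (∑< k f +_) (*-comm (A ^ w) A) ⟩
  ∑< k f + A ^ suc w                       ≡⟨ cong (λ e → ∑< k f + A ^ e) x∸k≡1+w ⟨
  ∑< k f + A ^ (x ∸ k)                     ≡⟨ ∑-phi-prime^ A-prime k (<⇒≤ k<x) ⟩
  A ^ x                                    ∎
  where
  open ≡-Reasoning
  instance _ = prime⇒nonZero A-prime
  f : ℕ → ℕ
  f i = phi (A ^ (x ∸ i))
  w = x ∸ suc k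
  x∸k≡1+w : x ∸ k ≡ suc w
  x∸k≡1+w = ∸≡suc∸suc k<x

-- Orders in ℤ/n

order : ℕ → ℕ → ℕ
order n k = ordSearch n k n 1

ordSearch-least : ∀ n k d₀ → (∀ j → n ∣ j * k → d₀ ∣ j) → n ∣ d₀ * k →
  ∀ fuel d → 1 ≤ d → d ≤ d₀ → d₀ ∸ d < fuel → ordSearch n k fuel d ≡ d₀
ordSearch-least n k d₀ least period (suc fuel) d@(suc _) _ d≤d₀ d₀∸d<fuel with n ∣? (d * k)
... | yes n∣dk = ≤-antisym d≤d₀ (∣⇒≤ (least d n∣dk))
... | no  n∤dk = ordSearch-least n k d₀ least period fuel (suc d) z<s d<d₀
                   (<-≤-trans (∸-monoʳ-< (n<1+n d) d<d₀) (≤-pred d₀∸d<fuel))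
  where
  d<d₀ : d < d₀
  d<d₀ = ≤∧≢⇒< d≤d₀ λ { refl → n∤dk period }

-- Writing n = d₀·g and k = u·g with g = gcd k n, the least d with n ∣ d·k is d₀, since gcd u d₀ = 1.
order*gcd : ∀ n k .{{_ : NonZero n}} → order n k * gcd k n ≡ n
order*gcd n k with gcd[m,n]∣n k n | gcd[m,n]∣m k n
... | divides d₀ n≡d₀g | divides u k≡ug = trans (cong (_* g) order≡d₀) (sym n≡d₀g)
  where
  g = gcd k n
  instance
    g≢0 : NonZero g
    g≢0 = ≢-nonZero (gcd[m,n]≢0 k n (inj₂ (≢-nonZero⁻¹ n)))
  d₀≢0 : NonZero d₀
  d₀≢0 = ≢-nonZero λ { refl → ≢-nonZero⁻¹ n n≡d₀g }
  d₀⊥u : Coprime d₀ u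
  d₀⊥u = Coprimality.sym (Coprimality.gcd≡1⇒coprime (*-cancelʳ-≡ (gcd u d₀) 1 g (begin
    gcd u d₀ * g              ≡⟨ *-comm (gcd u d₀) g ⟩
    g * gcd u d₀              ≡⟨ c*gcd[m,n]≡gcd[cm,cn] g u d₀ ⟩
    gcd (g * u) (g * d₀)      ≡⟨ cong₂ gcd (trans (*-comm g u) (sym k≡ug)) (trans (*-comm g d₀) (sym n≡d₀g)) ⟩
    gcd k n                   ≡⟨ *-identityˡ g ⟨
    1 * g                     ∎)))
    where open ≡-Reasoning
  least : ∀ j → n ∣ j * k → d₀ ∣ j
  least j n∣jk = coprime-divisor d₀⊥u (*-cancelʳ-∣ g (subst₂ _∣_ n≡d₀g (jk≡uj*g j) n∣jk))
    where
    jk≡uj*g : ∀ j → j * k ≡ u * j * g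
    jk≡uj*g j = trans (cong (j *_) k≡ug) (rearrange j u g)
      where
      rearrange : ∀ j u g → j * (u * g) ≡ u * j * g
      rearrange = solve-∀
  period : n ∣ d₀ * k
  period = divides u (begin
    d₀ * k          ≡⟨ cong (d₀ *_) k≡ug ⟩
    d₀ * (u * g)    ≡⟨ rearrange d₀ u g ⟩
    u * (d₀ * g)    ≡⟨ cong (u *_) n≡d₀g ⟨
    u * n           ∎)
    where
    open ≡-Reasoning
    rearrange : ∀ d u g → d * (u * g) ≡ u * (d * g)
    rearrange = solve-∀
  order≡d₀ : order n k ≡ d₀
  order≡d₀ = ordSearch-least n k d₀ least period n 1 ≤-refl (>-nonZero⁻¹ d₀ {{d₀≢0}})
               (≤-trans (∸-monoʳ-< {d₀} {1} {0} z<s (>-nonZero⁻¹ d₀ {{d₀≢0}})) (∣⇒≤ (divides g (trans n≡d₀g (*-comm d₀ g)))))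

module _ {D E : ℕ} .{{_ : NonZero D}} .{{_ : NonZero E}} where

  private instance
    DE≢0 : NonZero (D * E)
    DE≢0 = m*n≢0 D E

  order≡ᵇ : ∀ k → (order (D * E) k ≡ᵇ D) ≡ (gcd k (D * E) ≡ᵇ E)
  order≡ᵇ k = does-⇔ (mk⇔ ⇒gcd ⇒order) (order (D * E) k ≟ D) (gcd k (D * E) ≟ E)
    where
    ⇒gcd : order (D * E) k ≡ D → gcd k (D * E) ≡ E
    ⇒gcd eq = *-cancelˡ-≡ _ _ D (trans (cong (_* gcd k (D * E)) (sym eq)) (order*gcd (D * E) k))
    ⇒order : gcd k (D * E) ≡ E → order (D * E) k ≡ D
    ⇒order eq = *-cancelʳ-≡ _ _ E (trans (cong (order (D * E) k *_) (sym eq)) (order*gcd (D * E) k))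

  count-divisible : count (λ k → does (E ∣? k)) (D * E) ≡ D
  count-divisible = trans (count-multiples E (λ _ → true) D) (count-all D)

  count-gcd≡ : count (λ k → gcd k (D * E) ≡ᵇ E) (D * E) ≡ phi D
  count-gcd≡ = begin
    count level (D * E)                            ≡⟨ count-cong (D * E) (λ k _ → only-multiples k) ⟩
    count (λ k → level k ∧ does (E ∣? k)) (D * E)  ≡⟨ count-multiples E level D ⟩
    count (λ j → level (j * E)) D                  ≡⟨ count-cong D (λ j _ → does-⇔ (coprime⇔ j) (gcd (j * E) (D * E) ≟ E) (coprime? j D)) ⟩
    count (λ j → does (coprime? j D)) D            ≡⟨ phi-count D ⟨
    phi D                                          ∎
    where
    open ≡-Reasoning
    level : ℕ → Bool
    level k = gcd k (D * E) ≡ᵇ E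
    only-multiples : ∀ k → level k ≡ (level k ∧ does (E ∣? k))
    only-multiples k with gcd k (D * E) ≡ᵇ E in g≡ᵇE
    ... | false = refl
    ... | true  = sym (dec-true (E ∣? k) (subst (_∣ k) (≡ᵇ-true⇒ g≡ᵇE) (gcd[m,n]∣m k (D * E))))
    gcd-jE : ∀ j → gcd (j * E) (D * E) ≡ gcd j D * E
    gcd-jE j = trans (cong₂ gcd (*-comm j E) (*-comm D E)) (trans (sym (c*gcd[m,n]≡gcd[cm,cn] E j D)) (*-comm E (gcd j D)))
    coprime⇔ : ∀ j → (gcd (j * E) (D * E) ≡ E) ⇔ Coprime j D
    coprime⇔ j = mk⇔ ⇒coprime ⇒gcd
      where
      ⇒coprime : gcd (j * E) (D * E) ≡ E → Coprime j D
      ⇒coprime eq = Coprimality.gcd≡1⇒coprime (*-cancelʳ-≡ (gcd j D) 1 E (trans (sym (gcd-jE j)) (trans eq (sym (*-identityˡ E)))))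
      ⇒gcd : Coprime j D → gcd (j * E) (D * E) ≡ E
      ⇒gcd j⊥D = trans (gcd-jE j) (trans (cong (_* E) (Coprimality.coprime⇒gcd≡1 j⊥D)) (*-identityˡ E))

-- The set X for n = A^x B^y R

m*n-div-n : ∀ m n .{{_ : NonZero n}} → (m * n) div n ≡ m
m*n-div-n m (suc n) = m*n/n≡m m (suc n)

phiPowSum : ℕ → ℕ → ℕ → ℕ
phiPowSum A x s = ∑[ i < suc s ] phi (A ^ (x ∸ i))

module CardX {A B : ℕ} (A-prime : Prime A) (B-prime : Prime B) (A≢B : A ≢ B)
            {x y s t R : ℕ} (s≤x : s ≤ x) (t≤y : t ≤ y) (A∤R : ¬ A ∣ R) (B∤R : ¬ B ∣ R) where

  private instance
    A≢0 : NonZero A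
    A≢0 = prime⇒nonZero A-prime
    B≢0 : NonZero B
    B≢0 = prime⇒nonZero B-prime
    R≢0 : NonZero R
    R≢0 = ≢-nonZero λ { refl → A∤R (A ∣0) }

  N : ℕ
  N = A ^ x * B ^ y * R

  E D : ℕ → ℕ → ℕ
  E i j = A ^ i * B ^ j
  D i j = A ^ (x ∸ i) * B ^ (y ∸ j) * R

  E≢0 : ∀ i j → NonZero (E i j)
  E≢0 i j = m*n≢0 (A ^ i) (B ^ j) {{m^n≢0 A i}} {{m^n≢0 B j}}

  D≢0 : ∀ i j → NonZero (D i j)
  D≢0 i j = m*n≢0 _ R {{m*n≢0 (A ^ (x ∸ i)) (B ^ (y ∸ j)) {{m^n≢0 A (x ∸ i)}} {{m^n≢0 B (y ∸ j)}}}}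

  D*E≡N : ∀ {i j} → i ≤ x → j ≤ y → D i j * E i j ≡ N
  D*E≡N {i} {j} i≤x j≤y = begin
    A ^ (x ∸ i) * B ^ (y ∸ j) * R * (A ^ i * B ^ j)         ≡⟨ rearrange (A ^ (x ∸ i)) (B ^ (y ∸ j)) R (A ^ i) (B ^ j) ⟩
    A ^ (x ∸ i) * A ^ i * (B ^ (y ∸ j) * B ^ j) * R         ≡⟨ cong₂ (λ a b → a * b * R) (merge A i≤x) (merge B j≤y) ⟩
    A ^ x * B ^ y * R                                       ∎
    where
    open ≡-Reasoning
    rearrange : ∀ a b r a′ b′ → a * b * r * (a′ * b′) ≡ a * a′ * (b * b′) * r
    rearrange = solve-∀
    merge : ∀ C {i z} → i ≤ z → C ^ (z ∸ i) * C ^ i ≡ C ^ z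
    merge C {i} {z} i≤z = trans (sym (^-distribˡ-+-* C (z ∸ i) i)) (cong (C ^_) (m∸n+n≡m i≤z))

  N-div-E : ∀ {i j} → i ≤ x → j ≤ y → N div E i j ≡ D i j
  N-div-E {i} {j} i≤x j≤y = trans (cong (_div E i j) (sym (D*E≡N i≤x j≤y))) (m*n-div-n (D i j) (E i j) {{E≢0 i j}})

  -- the membership tests of Defs, read on representatives k < N
  inEₙ inSₙ : ℕ → ℕ → Bool
  inEₙ d k = order N k ≡ᵇ d
  inSₙ d k = ⌊ N ∣? (d * k) ⌋

  entry : ℕ → ℕ → ℕ → Bool
  entry i j k = not ((i ≡ᵇ s) ∧ (j ≡ᵇ t)) ∧ inEₙ (N div (A ^ i * B ^ j)) k

  inHₙ inKₙ inXₙ : ℕ → Bool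
  inHₙ k = any (λ i → any (λ j → entry i j k) (upTo (suc t))) (upTo (suc s))
  inKₙ k = inSₙ (N div (A ^ s * B ^ t)) k ∧ not (inEₙ (N div (A ^ s * B ^ t)) k)
  inXₙ k = inHₙ k ∨ inKₙ k

  cardX≡count : cardX N A B s t ≡ count inXₙ N
  cardX≡count = length-filterᵇ-tabulate (inX N A B s t) (λ i → i) inXₙ (λ _ → refl)

  level : ℕ → ℕ → ℕ → Bool
  level i j k = gcd k N ≡ᵇ E i j

  inE≡level : ∀ {i j} → i ≤ x → j ≤ y → ∀ k → inEₙ (N div E i j) k ≡ level i j k
  inE≡level {i} {j} i≤x j≤y k =
    trans (cong (order N k ≡ᵇ_) (N-div-E i≤x j≤y))
          (subst (λ n → (order n k ≡ᵇ D i j) ≡ (gcd k n ≡ᵇ E i j)) (D*E≡N i≤x j≤y)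
                 (order≡ᵇ {{D≢0 i j}} {{E≢0 i j}} k))

  count-level : ∀ {i j} → i ≤ x → j ≤ y → count (level i j) N ≡ phi (D i j)
  count-level {i} {j} i≤x j≤y =
    subst (λ n → count (λ k → gcd k n ≡ᵇ E i j) n ≡ phi (D i j)) (D*E≡N i≤x j≤y) (count-gcd≡ {{D≢0 i j}} {{E≢0 i j}})

  count-divisible-Est : count (λ k → does (E s t ∣? k)) N ≡ D s t
  count-divisible-Est =
    subst (λ n → count (λ k → does (E s t ∣? k)) n ≡ D s t) (D*E≡N s≤x t≤y) (count-divisible {{D≢0 s t}} {{E≢0 s t}})

  w : ℕ → ℕ → Bool
  w i j = not ((i ≡ᵇ s) ∧ (j ≡ᵇ t))

  entry≡ : ∀ {i j} → i ≤ s → j ≤ t → ∀ k → entry i j k ≡ (w i j ∧ level i j k)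
  entry≡ {i} {j} i≤s j≤t k = cong (w i j ∧_) (inE≡level (≤-trans i≤s s≤x) (≤-trans j≤t t≤y) k)

  entry⇒ : ∀ {i j} → i ≤ s → j ≤ t → ∀ k → entry i j k ≡ true → w i j ≡ true × gcd k N ≡ E i j
  entry⇒ {i} {j} i≤s j≤t k entry≡true =
    let w≡true , level≡true = ∧≡true⇒ (w i j) (level i j k) (trans (sym (entry≡ i≤s j≤t k)) entry≡true)
    in w≡true , ≡ᵇ-true⇒ level≡true

  row : ℕ → ℕ → Bool
  row i k = any (λ j → entry i j k) (upTo (suc t))

  row⇒ : ∀ {i} → i ≤ s → ∀ k → row i k ≡ true → ∃ λ j → j ≤ t × w i j ≡ true × gcd k N ≡ E i j
  row⇒ {i} i≤s k row≡true =
    let j , j<1+t , entry≡true = any-true⇒ (λ j → entry i j k) (λ j → j) (suc t) row≡true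
        w≡true , gcd≡E = entry⇒ i≤s (≤-pred j<1+t) k entry≡true
    in j , ≤-pred j<1+t , w≡true , gcd≡E

  -- distinct exponent pairs give distinct values of gcd k N, so the union defining H is disjoint
  count-H : count inHₙ N ≡ ∑[ i < suc s ] ∑[ j < suc t ] (indicator (w i j) * phi (D i j))
  count-H = begin
    count inHₙ N                                              ≡⟨ count-any row (λ i → i) (suc s) N rows-disjoint ⟩
    ∑[ i < suc s ] count (row i) N                            ≡⟨ ∑-cong (suc s) (λ i i<1+s → count-row (≤-pred i<1+s)) ⟩
    ∑[ i < suc s ] ∑[ j < suc t ] (indicator (w i j) * phi (D i j)) ∎
    where
    open ≡-Reasoning
    rows-disjoint : ∀ i i′ k → i < suc s → i′ < suc s → row i k ≡ true → row i′ k ≡ true → i ≡ i′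
    rows-disjoint i i′ k i<1+s i′<1+s rowᵢ rowᵢ′ =
      let j  , _ , _ , gcd≡Eᵢⱼ   = row⇒ (≤-pred i<1+s) k rowᵢ
          j′ , _ , _ , gcd≡Eᵢ′ⱼ′ = row⇒ (≤-pred i′<1+s) k rowᵢ′
      in proj₁ (^-*-^-injective A-prime B-prime A≢B i j i′ j′ (trans (sym gcd≡Eᵢⱼ) gcd≡Eᵢ′ⱼ′))
    count-row : ∀ {i} → i ≤ s → count (row i) N ≡ ∑[ j < suc t ] (indicator (w i j) * phi (D i j))
    count-row {i} i≤s = begin
      count (row i) N                                       ≡⟨ count-any (entry i) (λ j → j) (suc t) N entries-disjoint ⟩
      ∑[ j < suc t ] count (entry i j) N                    ≡⟨ ∑-cong (suc t) (λ j j<1+t → count-entry (≤-pred j<1+t)) ⟩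
      ∑[ j < suc t ] (indicator (w i j) * phi (D i j))      ∎
      where
      entries-disjoint : ∀ j j′ k → j < suc t → j′ < suc t → entry i j k ≡ true → entry i j′ k ≡ true → j ≡ j′
      entries-disjoint j j′ k j<1+t j′<1+t eᵢⱼ eᵢⱼ′ =
        proj₂ (^-*-^-injective A-prime B-prime A≢B i j i j′
                 (trans (sym (proj₂ (entry⇒ i≤s (≤-pred j<1+t) k eᵢⱼ))) (proj₂ (entry⇒ i≤s (≤-pred j′<1+t) k eᵢⱼ′))))
      count-entry : ∀ {j} → j ≤ t → count (entry i j) N ≡ indicator (w i j) * phi (D i j)
      count-entry {j} j≤t = begin
        count (entry i j) N                        ≡⟨ count-cong N (λ k _ → entry≡ i≤s j≤t k) ⟩
        count (λ k → w i j ∧ level i j k) N        ≡⟨ count-∧ˡ (w i j) (level i j) N ⟩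
        indicator (w i j) * count (level i j) N    ≡⟨ cong (indicator (w i j) *_) (count-level (≤-trans i≤s s≤x) (≤-trans j≤t t≤y)) ⟩
        indicator (w i j) * phi (D i j)            ∎

  inK≡ : ∀ k → inKₙ k ≡ (does (E s t ∣? k) ∧ not (level s t k))
  inK≡ k = cong₂ (λ a b → a ∧ not b) inS≡ (inE≡level s≤x t≤y k)
    where
    instance _ = D≢0 s t
    inS≡ : inSₙ (N div E s t) k ≡ does (E s t ∣? k)
    inS≡ = begin
      ⌊ N ∣? (N div E s t * k) ⌋
        ≡⟨ cong (λ d → ⌊ N ∣? (d * k) ⌋) (N-div-E s≤x t≤y) ⟩
      ⌊ N ∣? (D s t * k) ⌋
        ≡⟨ cong (λ n → ⌊ n ∣? (D s t * k) ⌋) (D*E≡N s≤x t≤y) ⟨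
      ⌊ D s t * E s t ∣? (D s t * k) ⌋
        ≡⟨ isYes≗does _ ⟩
      does (D s t * E s t ∣? (D s t * k))
        ≡⟨ does-⇔ (mk⇔ (*-cancelˡ-∣ (D s t)) (*-monoʳ-∣ (D s t))) (D s t * E s t ∣? (D s t * k)) (E s t ∣? k) ⟩
      does (E s t ∣? k) ∎
      where open ≡-Reasoning

  count-K : count inKₙ N + phi (D s t) ≡ D s t
  count-K = begin
    count inKₙ N + phi (D s t)
      ≡⟨ cong₂ _+_ (count-cong N (λ k _ → inK≡ k)) (sym (count-level s≤x t≤y)) ⟩
    count (λ k → divisible k ∧ not (level s t k)) N + count (level s t) N
      ≡⟨ cong (count (λ k → divisible k ∧ not (level s t k)) N +_) (count-cong N (λ k _ → level⇒divisible k)) ⟩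
    count (λ k → divisible k ∧ not (level s t k)) N + count (λ k → divisible k ∧ level s t k) N
      ≡⟨ +-comm (count (λ k → divisible k ∧ not (level s t k)) N) _ ⟩
    count (λ k → divisible k ∧ level s t k) N + count (λ k → divisible k ∧ not (level s t k)) N
      ≡⟨ count-partition divisible (level s t) N ⟨
    count divisible N
      ≡⟨ count-divisible-Est ⟩
    D s t ∎
    where
    open ≡-Reasoning
    divisible : ℕ → Bool
    divisible k = does (E s t ∣? k)
    level⇒divisible : ∀ k → level s t k ≡ (divisible k ∧ level s t k)
    level⇒divisible k with level s t k in level≡
    ... | false = sym (∧-zeroʳ (divisible k))
    ... | true  = cong (_∧ true) (sym (dec-true (E s t ∣? k) (subst (_∣ k) (≡ᵇ-true⇒ level≡) (gcd[m,n]∣m k N))))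

  w-corner : w s t ≡ false
  w-corner rewrite ≡ᵇ-refl s | ≡ᵇ-refl t = refl

  -- an element of H has gcd k N = A^i B^j with i < s or j < t, so A^s B^t ∤ k
  Est∤H : ∀ k → inHₙ k ≡ true → ¬ E s t ∣ k
  Est∤H k inH≡true Est∣k =
    let i , i<1+s , row≡true = any-true⇒ (λ i → row i k) (λ i → i) (suc s) inH≡true
        j , j≤t , w≡true , gcd≡E = row⇒ (≤-pred i<1+s) k row≡true
        Est∣Eij = subst (E s t ∣_) gcd≡E (gcd-greatest Est∣k (divides (D s t) (sym (D*E≡N s≤x t≤y))))
    in off-corner (≤-pred i<1+s) j≤t w≡true Est∣Eij
    where
    off-corner : ∀ {i j} → i ≤ s → j ≤ t → w i j ≡ true → ¬ E s t ∣ E i j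
    off-corner {i} {j} i≤s j≤t w≡true Est∣Eij with <-cmp i s
    ... | tri< i<s _ _ = ^∤^-* A-prime i<s (∤-^ A-prime j (∤-prime A-prime B-prime A≢B))
                            (∣-trans (divides (B ^ t) (*-comm (A ^ s) (B ^ t))) Est∣Eij)
    ... | tri> _ _ i>s = <⇒≱ i>s i≤s
    ... | tri≈ _ i≡s _ = ^∤^-* B-prime j<t (∤-^ B-prime i (∤-prime B-prime A-prime (A≢B ∘ sym)))
                            (∣-trans (divides (A ^ s) refl) (subst (E s t ∣_) (*-comm (A ^ i) (B ^ j)) Est∣Eij))
      where
      j<t : j < t
      j<t = ≤∧≢⇒< j≤t λ j≡t →
        contradiction (trans (sym w≡true) (subst₂ (λ i j → w i j ≡ false) (sym i≡s) (sym j≡t) w-corner)) λ ()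

  H∩K≡∅ : ∀ k → k < N → inHₙ k ≡ true → inKₙ k ≡ false
  H∩K≡∅ k _ inH≡true = trans (inK≡ k) (cong (λ b → b ∧ not (level s t k)) (dec-false (E s t ∣? k) (Est∤H k inH≡true)))

  phi-D : ∀ i j → phi (D i j) ≡ phi (A ^ (x ∸ i)) * phi (B ^ (y ∸ j)) * phi R
  phi-D i j = begin
    phi (A ^ (x ∸ i) * B ^ (y ∸ j) * R)
      ≡⟨ cong phi (*-assoc (A ^ (x ∸ i)) _ R) ⟩
    phi (A ^ (x ∸ i) * (B ^ (y ∸ j) * R))
      ≡⟨ phi-prime^-* (x ∸ i) _ A-prime (∤-* A-prime (∤-^ A-prime (y ∸ j) (∤-prime A-prime B-prime A≢B)) A∤R) ⟩
    phi (A ^ (x ∸ i)) * phi (B ^ (y ∸ j) * R)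
      ≡⟨ cong (phi (A ^ (x ∸ i)) *_) (phi-prime^-* (y ∸ j) R B-prime B∤R) ⟩
    phi (A ^ (x ∸ i)) * (phi (B ^ (y ∸ j)) * phi R)
      ≡⟨ *-assoc (phi (A ^ (x ∸ i))) _ (phi R) ⟨
    phi (A ^ (x ∸ i)) * phi (B ^ (y ∸ j)) * phi R ∎
    where open ≡-Reasoning

  ∑∑-phi-D : ∑[ i < suc s ] ∑[ j < suc t ] phi (D i j) ≡ phiPowSum A x s * phiPowSum B y t * phi R
  ∑∑-phi-D = begin
    ∑[ i < suc s ] ∑[ j < suc t ] phi (D i j)
      ≡⟨ ∑-cong (suc s) (λ i _ → ∑-cong (suc t) (λ j _ → trans (phi-D i j) (*-assoc (a i) (b j) (phi R)))) ⟩
    ∑[ i < suc s ] ∑[ j < suc t ] (a i * (b j * phi R))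
      ≡⟨ ∑-cong (suc s) (λ i _ → ∑-*ˡ (a i) (λ j → b j * phi R) (suc t)) ⟩
    ∑[ i < suc s ] (a i * ∑[ j < suc t ] (b j * phi R))
      ≡⟨ ∑-*ʳ (∑[ j < suc t ] (b j * phi R)) a (suc s) ⟩
    phiPowSum A x s * ∑[ j < suc t ] (b j * phi R)
      ≡⟨ cong (phiPowSum A x s *_) (∑-*ʳ (phi R) b (suc t)) ⟩
    phiPowSum A x s * (phiPowSum B y t * phi R)
      ≡⟨ *-assoc (phiPowSum A x s) _ (phi R) ⟨
    phiPowSum A x s * phiPowSum B y t * phi R ∎
    where
    open ≡-Reasoning
    a b : ℕ → ℕ
    a i = phi (A ^ (x ∸ i))
    b j = phi (B ^ (y ∸ j))

  -- |X| = |H| + |K|, where |H| + φ(D s t) is the full double sum and |K| + φ(D s t) = D s t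
  cardX-identity : cardX N A B s t + phi (D s t) + phi (D s t) ≡ phiPowSum A x s * phiPowSum B y t * phi R + D s t
  cardX-identity = begin
    cardX N A B s t + φD + φD
      ≡⟨ cong (λ c → c + φD + φD) (trans cardX≡count (count-∨ inHₙ inKₙ N H∩K≡∅)) ⟩
    count inHₙ N + count inKₙ N + φD + φD
      ≡⟨ rearrange (count inHₙ N) (count inKₙ N) φD ⟩
    (count inHₙ N + φD) + (count inKₙ N + φD)
      ≡⟨ cong₂ _+_ (cong (_+ φD) count-H) count-K ⟩
    ∑[ i < suc s ] ∑[ j < suc t ] (indicator (w i j) * phi (D i j)) + φD + D s t
      ≡⟨ cong (_+ D s t) (∑∑-except-corner (λ i j → phi (D i j)) s t) ⟩
    ∑[ i < suc s ] ∑[ j < suc t ] phi (D i j) + D s t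
      ≡⟨ cong (_+ D s t) ∑∑-phi-D ⟩
    phiPowSum A x s * phiPowSum B y t * phi R + D s t ∎
    where
    open ≡-Reasoning
    φD = phi (D s t)
    rearrange : ∀ h k p → h + k + p + p ≡ (h + p) + (k + p)
    rearrange = solve-∀

-- Rational arithmetic

ℚ-ring : AlmostCommutativeRing 0ℓ 0ℓ
ℚ-ring = fromCommutativeRing ℚ.+-*-commutativeRing (λ q → dec⇒maybe (0ℚ ℚ.≟ q))

two : ℚ
two = ℚ[ 2 ]

-- ℚ[ k ] and frac k (suc m) are fromℚᵘ of the evident unnormalised fractions, so identities
-- between them can be checked on numerators and denominators.
toℚᵘ-frac : ∀ k m → toℚᵘ (ℤ.+ k ℚ./ suc m) ≃ᵘ mkℚᵘ (ℤ.+ k) m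
toℚᵘ-frac k m = ℚ.toℚᵘ-fromℚᵘ (mkℚᵘ (ℤ.+ k) m)

ℚ-+ : ∀ m n → ℚ[ m + n ] ≡ ℚ[ m ] +q ℚ[ n ]
ℚ-+ m n = ℚ.toℚᵘ-injective (ℚᵘ.≃-trans (toℚᵘ-frac (m + n) 0) (ℚᵘ.≃-trans (*≡* same) (ℚᵘ.≃-sym
  (ℚᵘ.≃-trans (ℚ.toℚᵘ-homo-+ ℚ[ m ] ℚ[ n ]) (ℚᵘ.+-cong (toℚᵘ-frac m 0) (toℚᵘ-frac n 0))))))
  where
  same : ℤ.+ (m + n) ℤ.* ℤ.+ 1 ≡ (ℤ.+ m ℤ.* ℤ.+ 1 ℤ.+ ℤ.+ n ℤ.* ℤ.+ 1) ℤ.* ℤ.+ 1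
  same = trans (ℤ.*-identityʳ _) (trans (ℤ.pos-+ m n)
           (trans (cong₂ ℤ._+_ (sym (ℤ.*-identityʳ (ℤ.+ m))) (sym (ℤ.*-identityʳ (ℤ.+ n)))) (sym (ℤ.*-identityʳ _))))

ℚ-* : ∀ m n → ℚ[ m * n ] ≡ ℚ[ m ] *q ℚ[ n ]
ℚ-* m n = ℚ.toℚᵘ-injective (ℚᵘ.≃-trans (toℚᵘ-frac (m * n) 0) (ℚᵘ.≃-trans (*≡* same) (ℚᵘ.≃-sym
  (ℚᵘ.≃-trans (ℚ.toℚᵘ-homo-* ℚ[ m ] ℚ[ n ]) (ℚᵘ.*-cong (toℚᵘ-frac m 0) (toℚᵘ-frac n 0))))))
  where
  same : ℤ.+ (m * n) ℤ.* ℤ.+ 1 ≡ (ℤ.+ m ℤ.* ℤ.+ n) ℤ.* ℤ.+ 1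
  same = trans (ℤ.*-identityʳ _) (trans (ℤ.pos-* m n) (sym (ℤ.*-identityʳ _)))

ℚ-*₃ : ∀ a b c → ℚ[ a * b * c ] ≡ ℚ[ a ] *q ℚ[ b ] *q ℚ[ c ]
ℚ-*₃ a b c = trans (ℚ-* (a * b) c) (cong (_*q ℚ[ c ]) (ℚ-* a b))

a+b≡c⇒a≡c-b : ∀ {a b c} → a +q b ≡ c → a ≡ c -q b
a+b≡c⇒a≡c-b {a} {b} refl = a≡a+b-b a b
  where
  a≡a+b-b : ∀ a b → a ≡ a +q b -q b
  a≡a+b-b = Ring.solve-∀ ℚ-ring

a+b+b≡c⇒a≡c-2b : ∀ {a b c} → a +q b +q b ≡ c → a ≡ c -q two *q b
a+b+b≡c⇒a≡c-2b {a} {b} refl = a≡a+b+b-2b a b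
  where
  a≡a+b+b-2b : ∀ a b → a ≡ a +q b +q b -q two *q b
  a≡a+b+b-2b = Ring.solve-∀ ℚ-ring

ℚ-∸1 : ∀ {m} → 1 ≤ m → ℚ[ m ∸ 1 ] ≡ ℚ[ m ] -q 1ℚ
ℚ-∸1 {m} 1≤m = a+b≡c⇒a≡c-b (trans (sym (ℚ-+ (m ∸ 1) 1)) (cong ℚ[_] (m∸n+n≡m 1≤m)))

frac-split : ∀ k m → frac k m ≡ ℚ[ k ] *q frac 1 m
frac-split k zero    = sym (ℚ.*-zeroʳ ℚ[ k ])
frac-split k (suc m) = ℚ.toℚᵘ-injective (ℚᵘ.≃-trans (toℚᵘ-frac k m) (ℚᵘ.≃-trans (*≡* same) (ℚᵘ.≃-sym
  (ℚᵘ.≃-trans (ℚ.toℚᵘ-homo-* ℚ[ k ] (frac 1 (suc m))) (ℚᵘ.*-cong (toℚᵘ-frac k 0) (toℚᵘ-frac 1 m))))))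
  where
  same : ℤ.+ k ℤ.* ℤ.+ (1 * suc m) ≡ (ℤ.+ k ℤ.* ℤ.+ 1) ℤ.* ℤ.+ suc m
  same = trans (cong (λ d → ℤ.+ k ℤ.* ℤ.+ d) (*-identityˡ (suc m))) (cong (ℤ._* ℤ.+ suc m) (sym (ℤ.*-identityʳ (ℤ.+ k))))

frac-inverseʳ : ∀ m .{{_ : NonZero m}} → ℚ[ m ] *q frac 1 m ≡ 1ℚ
frac-inverseʳ (suc m) = ℚ.toℚᵘ-injective (ℚᵘ.≃-trans (ℚ.toℚᵘ-homo-* ℚ[ suc m ] (frac 1 (suc m)))
  (ℚᵘ.≃-trans (ℚᵘ.*-cong (toℚᵘ-frac (suc m) 0) (toℚᵘ-frac 1 m)) (*≡* same)))
  where
  same : (ℤ.+ suc m ℤ.* ℤ.+ 1) ℤ.* ℤ.+ 1 ≡ ℤ.+ 1 ℤ.* ℤ.+ (1 * suc m)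
  same = trans (ℤ.*-identityʳ _) (trans (ℤ.*-identityʳ _)
           (trans (cong ℤ.+_ (sym (*-identityˡ (suc m)))) (sym (ℤ.*-identityˡ _))))

frac-1-* : ∀ m n .{{_ : NonZero m}} .{{_ : NonZero n}} → frac 1 (m * n) ≡ frac 1 m *q frac 1 n
frac-1-* (suc m) (suc n) = ℚ.toℚᵘ-injective (ℚᵘ.≃-trans (toℚᵘ-frac 1 (n + m * suc n)) (ℚᵘ.≃-sym
  (ℚᵘ.≃-trans (ℚ.toℚᵘ-homo-* (frac 1 (suc m)) (frac 1 (suc n))) (ℚᵘ.*-cong (toℚᵘ-frac 1 m) (toℚᵘ-frac 1 n)))))

frac-*-split : ∀ k m n .{{_ : NonZero m}} .{{_ : NonZero n}} → frac k (m * n) ≡ ℚ[ k ] *q frac 1 m *q frac 1 n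
frac-*-split k m n = trans (frac-split k (m * n)) (trans (cong (ℚ[ k ] *q_) (frac-1-* m n)) (sym (ℚ.*-assoc ℚ[ k ] _ _)))

frac-exact : ∀ j m .{{_ : NonZero m}} → frac (j * m) m ≡ ℚ[ j ]
frac-exact j m = begin
  frac (j * m) m                       ≡⟨ frac-split (j * m) m ⟩
  ℚ[ j * m ] *q frac 1 m              ≡⟨ cong (_*q frac 1 m) (ℚ-* j m) ⟩
  ℚ[ j ] *q ℚ[ m ] *q frac 1 m       ≡⟨ ℚ.*-assoc ℚ[ j ] ℚ[ m ] (frac 1 m) ⟩
  ℚ[ j ] *q (ℚ[ m ] *q frac 1 m)     ≡⟨ cong (ℚ[ j ] *q_) (frac-inverseʳ m) ⟩
  ℚ[ j ] *q 1ℚ                        ≡⟨ ℚ.*-identityʳ ℚ[ j ] ⟩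
  ℚ[ j ]                               ∎
  where open ≡-Reasoning

frac-*-cancelʳ : ∀ k m e .{{_ : NonZero m}} .{{_ : NonZero e}} → frac (k * e) (m * e) ≡ frac k m
frac-*-cancelʳ k m e = begin
  frac (k * e) (m * e)                                      ≡⟨ frac-split (k * e) (m * e) ⟩
  ℚ[ k * e ] *q frac 1 (m * e)                             ≡⟨ cong₂ _*q_ (ℚ-* k e) (frac-1-* m e) ⟩
  ℚ[ k ] *q ℚ[ e ] *q (frac 1 m *q frac 1 e)             ≡⟨ rearrange ℚ[ k ] ℚ[ e ] (frac 1 m) (frac 1 e) ⟩
  ℚ[ k ] *q frac 1 m *q (ℚ[ e ] *q frac 1 e)             ≡⟨ cong (ℚ[ k ] *q frac 1 m *q_) (frac-inverseʳ e) ⟩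
  ℚ[ k ] *q frac 1 m *q 1ℚ                                ≡⟨ ℚ.*-identityʳ _ ⟩
  ℚ[ k ] *q frac 1 m                                       ≡⟨ frac-split k m ⟨
  frac k m                                                  ∎
  where
  open ≡-Reasoning
  rearrange : ∀ a b c d → a *q b *q (c *q d) ≡ a *q c *q (b *q d)
  rearrange = Ring.solve-∀ ℚ-ring

clear₂ : ∀ c d ia ib → c *q ia ≡ 1ℚ → d *q ib ≡ 1ℚ → ∀ a₀ a₁ a₂ a₃ →
  c *q d *q (a₀ +q a₁ *q ia +q a₂ *q ib +q a₃ *q (ia *q ib)) ≡ c *q d *q a₀ +q d *q a₁ +q c *q a₂ +q a₃
clear₂ c d ia ib c·ia≡1 d·ib≡1 a₀ a₁ a₂ a₃ = begin
  c *q d *q (a₀ +q a₁ *q ia +q a₂ *q ib +q a₃ *q (ia *q ib))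
    ≡⟨ Ring.solve (c ∷ d ∷ ia ∷ ib ∷ a₀ ∷ a₁ ∷ a₂ ∷ a₃ ∷ []) ℚ-ring ⟩
  c *q d *q a₀ +q d *q a₁ *q (c *q ia) +q c *q a₂ *q (d *q ib) +q a₃ *q ((c *q ia) *q (d *q ib))
    ≡⟨ cong₂ (λ γ δ → c *q d *q a₀ +q d *q a₁ *q γ +q c *q a₂ *q δ +q a₃ *q (γ *q δ)) c·ia≡1 d·ib≡1 ⟩
  c *q d *q a₀ +q d *q a₁ *q 1ℚ +q c *q a₂ *q 1ℚ +q a₃ *q (1ℚ *q 1ℚ)
    ≡⟨ Ring.solve (c ∷ d ∷ a₀ ∷ a₁ ∷ a₂ ∷ a₃ ∷ []) ℚ-ring ⟩
  c *q d *q a₀ +q d *q a₁ +q c *q a₂ +q a₃ ∎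
  where open ≡-Reasoning

-- The formula θ

-- Here α and β stand for p_a and p_b, Q for the
-- product of the other primes, F for φ(Q) and L for the product of their powers p_i^(n_i - 1); c and d
-- stand for the denominators p_a^s (or p_a^(n_a - 1)) and p_b^t (or p_b^(n_b - 1)), and u and v for
-- p_a^(n_a - 1 - s) and p_b^(n_b - 1 - t).
module _ (α β L F Q : ℚ) where

  θ-algebra-≡-≡ : ∀ {card φn K φab φa φb f₂ fP ia ib} (c d : ℚ) →
    card ≡ α *q c *q (β *q d) *q (L *q F) +q 1ℚ *q 1ℚ *q (L *q Q) -q two *q (1ℚ *q 1ℚ *q (L *q F)) →
    φn ≡ c *q (α -q 1ℚ) *q (d *q (β -q 1ℚ)) *q (L *q F) → K ≡ c *q d *q L →
    φab ≡ F → φa ≡ (β -q 1ℚ) *q F → φb ≡ (α -q 1ℚ) *q F →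
    c *q ia ≡ 1ℚ → d *q ib ≡ 1ℚ → f₂ ≡ two *q ia *q ib → fP ≡ Q *q ia *q ib →
    card ≡ φn +q K *q (φab *q (1ℚ -q f₂) +q φa +q φb +q fP)
  θ-algebra-≡-≡ {ia = ia} {ib} c d refl refl refl refl refl refl c·ia≡1 d·ib≡1 refl refl = sym (begin
    c *q (α -q 1ℚ) *q (d *q (β -q 1ℚ)) *q (L *q F)
      +q c *q d *q L *q (F *q (1ℚ -q two *q ia *q ib) +q (β -q 1ℚ) *q F +q (α -q 1ℚ) *q F +q Q *q ia *q ib)
      ≡⟨ Ring.solve (α ∷ β ∷ L ∷ F ∷ Q ∷ c ∷ d ∷ ia ∷ ib ∷ []) ℚ-ring ⟩
    c *q (α -q 1ℚ) *q (d *q (β -q 1ℚ)) *q (L *q F)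
      +q L *q (c *q d *q ((α +q β -q 1ℚ) *q F +q 0ℚ *q ia +q 0ℚ *q ib +q (Q -q two *q F) *q (ia *q ib)))
      ≡⟨ cong (λ z → c *q (α -q 1ℚ) *q (d *q (β -q 1ℚ)) *q (L *q F) +q L *q z)
              (clear₂ c d ia ib c·ia≡1 d·ib≡1 ((α +q β -q 1ℚ) *q F) 0ℚ 0ℚ (Q -q two *q F)) ⟩
    c *q (α -q 1ℚ) *q (d *q (β -q 1ℚ)) *q (L *q F)
      +q L *q (c *q d *q ((α +q β -q 1ℚ) *q F) +q d *q 0ℚ +q c *q 0ℚ +q (Q -q two *q F))
      ≡⟨ Ring.solve (α ∷ β ∷ L ∷ F ∷ Q ∷ c ∷ d ∷ []) ℚ-ring ⟩
    α *q c *q (β *q d) *q (L *q F) +q 1ℚ *q 1ℚ *q (L *q Q) -q two *q (1ℚ *q 1ℚ *q (L *q F)) ∎)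
    where open ≡-Reasoning

  θ-algebra-≡-< : ∀ {card φn K φab φa φb f₂ fP ia ib} (c d v : ℚ) →
    card ≡ α *q c *q (d *q β *q v -q v) *q (L *q F) +q 1ℚ *q (β *q v) *q (L *q Q) -q two *q (1ℚ *q (v *q (β -q 1ℚ)) *q (L *q F)) →
    φn ≡ c *q (α -q 1ℚ) *q (d *q v *q (β -q 1ℚ)) *q (L *q F) → K ≡ c *q (d *q v) *q L →
    φab ≡ F → φa ≡ (β -q 1ℚ) *q F → φb ≡ (α -q 1ℚ) *q F →
    c *q ia ≡ 1ℚ → d *q ib ≡ 1ℚ → f₂ ≡ two *q ia *q ib → fP ≡ β *q Q *q ia *q ib →
    card ≡ φn +q K *q (φab *q (1ℚ -q ib) +q φa *q (1ℚ -q f₂) +q φb *q (1ℚ -q ib) +q fP)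
  θ-algebra-≡-< {ia = ia} {ib} c d v refl refl refl refl refl refl c·ia≡1 d·ib≡1 refl refl = sym (begin
    c *q (α -q 1ℚ) *q (d *q v *q (β -q 1ℚ)) *q (L *q F)
      +q c *q (d *q v) *q L *q (F *q (1ℚ -q ib) +q (β -q 1ℚ) *q F *q (1ℚ -q two *q ia *q ib) +q (α -q 1ℚ) *q F *q (1ℚ -q ib) +q β *q Q *q ia *q ib)
      ≡⟨ Ring.solve (α ∷ β ∷ L ∷ F ∷ Q ∷ c ∷ d ∷ v ∷ ia ∷ ib ∷ []) ℚ-ring ⟩
    c *q (α -q 1ℚ) *q (d *q v *q (β -q 1ℚ)) *q (L *q F)
      +q v *q L *q (c *q d *q ((α +q β -q 1ℚ) *q F +q 0ℚ *q ia +q (0ℚ -q α *q F) *q ib +q (β *q Q -q two *q (β -q 1ℚ) *q F) *q (ia *q ib)))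
      ≡⟨ cong (λ z → c *q (α -q 1ℚ) *q (d *q v *q (β -q 1ℚ)) *q (L *q F) +q v *q L *q z)
              (clear₂ c d ia ib c·ia≡1 d·ib≡1 ((α +q β -q 1ℚ) *q F) 0ℚ (0ℚ -q α *q F) (β *q Q -q two *q (β -q 1ℚ) *q F)) ⟩
    c *q (α -q 1ℚ) *q (d *q v *q (β -q 1ℚ)) *q (L *q F)
      +q v *q L *q (c *q d *q ((α +q β -q 1ℚ) *q F) +q d *q 0ℚ +q c *q (0ℚ -q α *q F) +q (β *q Q -q two *q (β -q 1ℚ) *q F))
      ≡⟨ Ring.solve (α ∷ β ∷ L ∷ F ∷ Q ∷ c ∷ d ∷ v ∷ []) ℚ-ring ⟩
    α *q c *q (d *q β *q v -q v) *q (L *q F) +q 1ℚ *q (β *q v) *q (L *q Q) -q two *q (1ℚ *q (v *q (β -q 1ℚ)) *q (L *q F)) ∎)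
    where open ≡-Reasoning

  θ-algebra-<-≡ : ∀ {card φn K φab φa φb f₂ fP ia ib} (c u d : ℚ) →
    card ≡ (c *q α *q u -q u) *q (β *q d) *q (L *q F) +q α *q u *q 1ℚ *q (L *q Q) -q two *q (u *q (α -q 1ℚ) *q 1ℚ *q (L *q F)) →
    φn ≡ c *q u *q (α -q 1ℚ) *q (d *q (β -q 1ℚ)) *q (L *q F) → K ≡ c *q u *q d *q L →
    φab ≡ F → φa ≡ (β -q 1ℚ) *q F → φb ≡ (α -q 1ℚ) *q F →
    c *q ia ≡ 1ℚ → d *q ib ≡ 1ℚ → f₂ ≡ two *q ia *q ib → fP ≡ α *q Q *q ia *q ib →
    card ≡ φn +q K *q (φab *q (1ℚ -q ia) +q φa *q (1ℚ -q ia) +q φb *q (1ℚ -q f₂) +q fP)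
  θ-algebra-<-≡ {ia = ia} {ib} c u d refl refl refl refl refl refl c·ia≡1 d·ib≡1 refl refl = sym (begin
    c *q u *q (α -q 1ℚ) *q (d *q (β -q 1ℚ)) *q (L *q F)
      +q c *q u *q d *q L *q (F *q (1ℚ -q ia) +q (β -q 1ℚ) *q F *q (1ℚ -q ia) +q (α -q 1ℚ) *q F *q (1ℚ -q two *q ia *q ib) +q α *q Q *q ia *q ib)
      ≡⟨ Ring.solve (α ∷ β ∷ L ∷ F ∷ Q ∷ c ∷ u ∷ d ∷ ia ∷ ib ∷ []) ℚ-ring ⟩
    c *q u *q (α -q 1ℚ) *q (d *q (β -q 1ℚ)) *q (L *q F)
      +q u *q L *q (c *q d *q ((α +q β -q 1ℚ) *q F +q (0ℚ -q β *q F) *q ia +q 0ℚ *q ib +q (α *q Q -q two *q (α -q 1ℚ) *q F) *q (ia *q ib)))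
      ≡⟨ cong (λ z → c *q u *q (α -q 1ℚ) *q (d *q (β -q 1ℚ)) *q (L *q F) +q u *q L *q z)
              (clear₂ c d ia ib c·ia≡1 d·ib≡1 ((α +q β -q 1ℚ) *q F) (0ℚ -q β *q F) 0ℚ (α *q Q -q two *q (α -q 1ℚ) *q F)) ⟩
    c *q u *q (α -q 1ℚ) *q (d *q (β -q 1ℚ)) *q (L *q F)
      +q u *q L *q (c *q d *q ((α +q β -q 1ℚ) *q F) +q d *q (0ℚ -q β *q F) +q c *q 0ℚ +q (α *q Q -q two *q (α -q 1ℚ) *q F))
      ≡⟨ Ring.solve (α ∷ β ∷ L ∷ F ∷ Q ∷ c ∷ u ∷ d ∷ []) ℚ-ring ⟩
    (c *q α *q u -q u) *q (β *q d) *q (L *q F) +q α *q u *q 1ℚ *q (L *q Q) -q two *q (u *q (α -q 1ℚ) *q 1ℚ *q (L *q F)) ∎)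
    where open ≡-Reasoning

  θ-algebra-<-< : ∀ {card φn K φab φa φb f₂ fP ia ib} (c u d v : ℚ) →
    card ≡ (c *q α *q u -q u) *q (d *q β *q v -q v) *q (L *q F) +q α *q u *q (β *q v) *q (L *q Q)
             -q two *q (u *q (α -q 1ℚ) *q (v *q (β -q 1ℚ)) *q (L *q F)) →
    φn ≡ c *q u *q (α -q 1ℚ) *q (d *q v *q (β -q 1ℚ)) *q (L *q F) → K ≡ c *q u *q (d *q v) *q L →
    φab ≡ F → φa ≡ (β -q 1ℚ) *q F → φb ≡ (α -q 1ℚ) *q F →
    c *q ia ≡ 1ℚ → d *q ib ≡ 1ℚ → f₂ ≡ two *q ((α -q 1ℚ) *q ((β -q 1ℚ) *q F)) *q ia *q ib → fP ≡ α *q β *q Q *q ia *q ib →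
    card ≡ φn +q K *q (φab *q (1ℚ -q ia) *q (1ℚ -q ib) +q φa *q (1ℚ -q ia) +q φb *q (1ℚ -q ib) -q f₂ +q fP)
  θ-algebra-<-< {ia = ia} {ib} c u d v refl refl refl refl refl refl c·ia≡1 d·ib≡1 refl refl = sym (begin
    c *q u *q (α -q 1ℚ) *q (d *q v *q (β -q 1ℚ)) *q (L *q F)
      +q c *q u *q (d *q v) *q L *q (F *q (1ℚ -q ia) *q (1ℚ -q ib) +q (β -q 1ℚ) *q F *q (1ℚ -q ia) +q (α -q 1ℚ) *q F *q (1ℚ -q ib)
                                     -q two *q ((α -q 1ℚ) *q ((β -q 1ℚ) *q F)) *q ia *q ib +q α *q β *q Q *q ia *q ib)
      ≡⟨ Ring.solve (α ∷ β ∷ L ∷ F ∷ Q ∷ c ∷ u ∷ d ∷ v ∷ ia ∷ ib ∷ []) ℚ-ring ⟩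
    c *q u *q (α -q 1ℚ) *q (d *q v *q (β -q 1ℚ)) *q (L *q F)
      +q u *q v *q L *q (c *q d *q ((α +q β -q 1ℚ) *q F +q (0ℚ -q β *q F) *q ia +q (0ℚ -q α *q F) *q ib
                                    +q (F -q two *q (α -q 1ℚ) *q (β -q 1ℚ) *q F +q α *q β *q Q) *q (ia *q ib)))
      ≡⟨ cong (λ z → c *q u *q (α -q 1ℚ) *q (d *q v *q (β -q 1ℚ)) *q (L *q F) +q u *q v *q L *q z)
              (clear₂ c d ia ib c·ia≡1 d·ib≡1 ((α +q β -q 1ℚ) *q F) (0ℚ -q β *q F) (0ℚ -q α *q F)
                                              (F -q two *q (α -q 1ℚ) *q (β -q 1ℚ) *q F +q α *q β *q Q)) ⟩
    c *q u *q (α -q 1ℚ) *q (d *q v *q (β -q 1ℚ)) *q (L *q F)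
      +q u *q v *q L *q (c *q d *q ((α +q β -q 1ℚ) *q F) +q d *q (0ℚ -q β *q F) +q c *q (0ℚ -q α *q F)
                         +q (F -q two *q (α -q 1ℚ) *q (β -q 1ℚ) *q F +q α *q β *q Q))
      ≡⟨ Ring.solve (α ∷ β ∷ L ∷ F ∷ Q ∷ c ∷ u ∷ d ∷ v ∷ []) ℚ-ring ⟩
    (c *q α *q u -q u) *q (d *q β *q v -q v) *q (L *q F) +q α *q u *q (β *q v) *q (L *q Q)
      -q two *q (u *q (α -q 1ℚ) *q (v *q (β -q 1ℚ)) *q (L *q F)) ∎)
    where open ≡-Reasoning

profile : ℕ → ℕ → ℕ → ℚ × ℚ × ℚ
profile A x s = ℚ[ phiPowSum A x s ] , ℚ[ A ^ (x ∸ s) ] , ℚ[ phi (A ^ (x ∸ s)) ]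

cardFormula : ℚ × ℚ × ℚ → ℚ × ℚ × ℚ → ℚ → ℚ → ℚ → ℚ
cardFormula (σa , da , φda) (σb , db , φdb) L F Q =
  σa *q σb *q (L *q F) +q da *q db *q (L *q Q) -q two *q (φda *q φdb *q (L *q F))

module _ {A : ℕ} (A-prime : Prime A) where

  private instance _ = prime⇒nonZero A-prime

  ^-pred : ∀ {x} → 1 ≤ x → A ^ x ≡ A * A ^ (x ∸ 1)
  ^-pred {suc x} _ = refl

  ℚ-phi-prime^ : ∀ {x} → 1 ≤ x → ℚ[ phi (A ^ x) ] ≡ ℚ[ A ^ (x ∸ 1) ] *q (ℚ[ A ] -q 1ℚ)
  ℚ-phi-prime^ {suc x} _ = trans (cong ℚ[_] (phi-prime^suc x A-prime)) (trans (ℚ-* (A ^ x) (A ∸ 1)) (cong (ℚ[ A ^ x ] *q_) (ℚ-∸1 (>-nonZero⁻¹ A))))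

  module _ {x s : ℕ} (s<x : s < x) where

    private
      u = x ∸ suc s
      x≡s+1+u : x ≡ s + suc u
      x≡s+1+u = trans (sym (m+[n∸m]≡n s<x)) (sym (+-suc s u))

    ℚ-^-pred-< : ℚ[ A ^ (x ∸ 1) ] ≡ ℚ[ A ^ s ] *q ℚ[ A ^ u ]
    ℚ-^-pred-< = begin
      ℚ[ A ^ (x ∸ 1) ]          ≡⟨ cong (λ e → ℚ[ A ^ (e ∸ 1) ]) x≡s+1+u ⟩
      ℚ[ A ^ (s + suc u ∸ 1) ]  ≡⟨ cong (λ e → ℚ[ A ^ (e ∸ 1) ]) (+-suc s u) ⟩
      ℚ[ A ^ (s + u) ]          ≡⟨ cong ℚ[_] (^-distribˡ-+-* A s u) ⟩
      ℚ[ A ^ s * A ^ u ]        ≡⟨ ℚ-* (A ^ s) (A ^ u) ⟩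
      ℚ[ A ^ s ] *q ℚ[ A ^ u ]  ∎
      where open ≡-Reasoning

    profile-< : profile A x s ≡ (ℚ[ A ^ s ] *q ℚ[ A ] *q ℚ[ A ^ u ] -q ℚ[ A ^ u ] , ℚ[ A ] *q ℚ[ A ^ u ] , ℚ[ A ^ u ] *q (ℚ[ A ] -q 1ℚ))
    profile-< = cong₂ _,_ σ≡ (cong₂ _,_ (trans (cong ℚ[_] x∸s≡1+u) (ℚ-* A (A ^ u)))
                                     (trans (cong (λ m → ℚ[ phi m ]) x∸s≡1+u) (ℚ-phi-prime^ {suc u} z<s)))
      where
      x∸s≡1+u : A ^ (x ∸ s) ≡ A ^ suc u
      x∸s≡1+u = cong (A ^_) (∸≡suc∸suc s<x)
      σ≡ : ℚ[ phiPowSum A x s ] ≡ ℚ[ A ^ s ] *q ℚ[ A ] *q ℚ[ A ^ u ] -q ℚ[ A ^ u ]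
      σ≡ = a+b≡c⇒a≡c-b (begin
        ℚ[ phiPowSum A x s ] +q ℚ[ A ^ u ]        ≡⟨ ℚ-+ (phiPowSum A x s) (A ^ u) ⟨
        ℚ[ phiPowSum A x s + A ^ u ]             ≡⟨ cong ℚ[_] (∑-phi-prime^ A-prime (suc s) s<x) ⟩
        ℚ[ A ^ x ]                               ≡⟨ cong (λ e → ℚ[ A ^ e ]) x≡s+1+u ⟩
        ℚ[ A ^ (s + suc u) ]                     ≡⟨ cong ℚ[_] (^-distribˡ-+-* A s (suc u)) ⟩
        ℚ[ A ^ s * (A * A ^ u) ]                 ≡⟨ cong ℚ[_] (*-assoc (A ^ s) A (A ^ u)) ⟨
        ℚ[ A ^ s * A * A ^ u ]                   ≡⟨ ℚ-*₃ (A ^ s) A (A ^ u) ⟩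
        ℚ[ A ^ s ] *q ℚ[ A ] *q ℚ[ A ^ u ]       ∎)
        where open ≡-Reasoning

  profile-≡ : ∀ {x} → 1 ≤ x → profile A x x ≡ (ℚ[ A ] *q ℚ[ A ^ (x ∸ 1) ] , 1ℚ , 1ℚ)
  profile-≡ {x} 1≤x = cong₂ _,_ σ≡ (cong₂ _,_ (cong (λ e → ℚ[ A ^ e ]) (n∸n≡0 x)) (cong (λ e → ℚ[ phi (A ^ e) ]) (n∸n≡0 x)))
    where
    σ≡ : ℚ[ phiPowSum A x x ] ≡ ℚ[ A ] *q ℚ[ A ^ (x ∸ 1) ]
    σ≡ = begin
      ℚ[ phiPowSum A x x ]                              ≡⟨ cong ℚ[_] (∑-last (λ i → phi (A ^ (x ∸ i))) x) ⟩
      ℚ[ ∑[ i < x ] phi (A ^ (x ∸ i)) + phi (A ^ (x ∸ x)) ] ≡⟨ cong (λ e → ℚ[ ∑[ i < x ] phi (A ^ (x ∸ i)) + phi (A ^ e) ]) (n∸n≡0 x) ⟩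
      ℚ[ ∑[ i < x ] phi (A ^ (x ∸ i)) + A ^ 0 ]         ≡⟨ cong (λ e → ℚ[ ∑[ i < x ] phi (A ^ (x ∸ i)) + A ^ e ]) (n∸n≡0 x) ⟨
      ℚ[ ∑[ i < x ] phi (A ^ (x ∸ i)) + A ^ (x ∸ x) ]   ≡⟨ cong ℚ[_] (∑-phi-prime^ A-prime x ≤-refl) ⟩
      ℚ[ A ^ x ]                                        ≡⟨ cong ℚ[_] (^-pred 1≤x) ⟩
      ℚ[ A * A ^ (x ∸ 1) ]                              ≡⟨ ℚ-* A (A ^ (x ∸ 1)) ⟩
      ℚ[ A ] *q ℚ[ A ^ (x ∸ 1) ]                        ∎
      where open ≡-Reasoning

-- θ with its two case distinctions abstracted, so that a branch can be selected by rewriting a Bool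
θ-branches : (n P pa pb na nb s t : ℕ) → Bool → Bool → ℚ
θ-branches n P pa pb na nb s t s≡na t≡nb = ℚ[ phi n ] +q frac n P *q v
  where
  φab = ℚ[ phi (P div (pa * pb)) ]
  φa  = ℚ[ phi (P div pa) ]
  φb  = ℚ[ phi (P div pb) ]
  v : ℚ
  v = if s≡na then
        (if t≡nb then
           φab *q (1ℚ -q frac 2 (pa ^ (na ∸ 1) * pb ^ (nb ∸ 1))) +q φa +q φb
             +q frac P (pa ^ na * pb ^ nb)
         else
           φab *q (1ℚ -q frac 1 (pb ^ t)) +q φa *q (1ℚ -q frac 2 (pa ^ (na ∸ 1) * pb ^ t))
             +q φb *q (1ℚ -q frac 1 (pb ^ t)) +q frac P (pa ^ na * pb ^ t))
      else
        (if t≡nb then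
           φab *q (1ℚ -q frac 1 (pa ^ s)) +q φa *q (1ℚ -q frac 1 (pa ^ s))
             +q φb *q (1ℚ -q frac 2 (pa ^ s * pb ^ (nb ∸ 1))) +q frac P (pa ^ s * pb ^ nb)
         else
           (φab *q (1ℚ -q frac 1 (pa ^ s))) *q (1ℚ -q frac 1 (pb ^ t)) +q φa *q (1ℚ -q frac 1 (pa ^ s))
             +q φb *q (1ℚ -q frac 1 (pb ^ t)) -q frac (2 * phi P) (pa ^ s * pb ^ t)
             +q frac P (pa ^ s * pb ^ t))

-- n = A^x B^y (L Q) and P = A B Q, where Q is the product of the other primes and L the rest of n
module CardXTheta {A B : ℕ} (A-prime : Prime A) (B-prime : Prime B) (A≢B : A ≢ B)
                   {x y s t L Q : ℕ} (1≤s : 1 ≤ s) (s≤x : s ≤ x) (1≤t : 1 ≤ t) (t≤y : t ≤ y)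
                   (A∤LQ : ¬ A ∣ L * Q) (B∤LQ : ¬ B ∣ L * Q) (rad : ∀ {k} → Coprime k Q → Coprime k L) where

  open CardX A-prime B-prime A≢B s≤x t≤y A∤LQ B∤LQ using (N; D; cardX-identity; phi-D)

  private instance
    A≢0 : NonZero A
    A≢0 = prime⇒nonZero A-prime
    B≢0 : NonZero B
    B≢0 = prime⇒nonZero B-prime
    Q≢0 : NonZero Q
    Q≢0 = ≢-nonZero λ { refl → A∤LQ (subst (A ∣_) (sym (*-zeroʳ L)) (A ∣0)) }
    A*B≢0 : NonZero (A * B)
    A*B≢0 = m*n≢0 A B
    A^s≢0 : NonZero (A ^ s)
    A^s≢0 = m^n≢0 A s
    A^x-1≢0 : NonZero (A ^ (x ∸ 1))
    A^x-1≢0 = m^n≢0 A (x ∸ 1)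
    B^t≢0 : NonZero (B ^ t)
    B^t≢0 = m^n≢0 B t
    B^y-1≢0 : NonZero (B ^ (y ∸ 1))
    B^y-1≢0 = m^n≢0 B (y ∸ 1)

  P F : ℕ
  P = A * B * Q
  F = phi Q

  α β : ℚ
  α = ℚ[ A ]
  β = ℚ[ B ]

  A∤Q : ¬ A ∣ Q
  A∤Q A∣Q = A∤LQ (∣n⇒∣m*n L A∣Q)
  B∤Q : ¬ B ∣ Q
  B∤Q B∣Q = B∤LQ (∣n⇒∣m*n L B∣Q)

  phi-LQ : phi (L * Q) ≡ L * F
  phi-LQ = phi-*-sameRadical L Q rad

  card-ℚ : ℚ[ cardX N A B s t ] ≡ cardFormula (profile A x s) (profile B y t) ℚ[ L ] ℚ[ F ] ℚ[ Q ]
  card-ℚ = trans (a+b+b≡c⇒a≡c-2b card+2φD) (cong (λ z → main -q two *q z) ℚ-φD)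
    where
    open ≡-Reasoning
    card = cardX N A B s t
    φD = phi (D s t)
    ℚ-φR : ℚ[ phi (L * Q) ] ≡ ℚ[ L ] *q ℚ[ F ]
    ℚ-φR = trans (cong ℚ[_] phi-LQ) (ℚ-* L F)
    ℚ-φD : ℚ[ φD ] ≡ ℚ[ phi (A ^ (x ∸ s)) ] *q ℚ[ phi (B ^ (y ∸ t)) ] *q (ℚ[ L ] *q ℚ[ F ])
    ℚ-φD = trans (cong ℚ[_] (phi-D s t)) (trans (ℚ-*₃ (phi (A ^ (x ∸ s))) (phi (B ^ (y ∸ t))) (phi (L * Q)))
                                            (cong (ℚ[ phi (A ^ (x ∸ s)) ] *q ℚ[ phi (B ^ (y ∸ t)) ] *q_) ℚ-φR))
    main : ℚ
    main = ℚ[ phiPowSum A x s ] *q ℚ[ phiPowSum B y t ] *q (ℚ[ L ] *q ℚ[ F ]) +q ℚ[ A ^ (x ∸ s) ] *q ℚ[ B ^ (y ∸ t) ] *q (ℚ[ L ] *q ℚ[ Q ])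
    card+2φD : ℚ[ card ] +q ℚ[ φD ] +q ℚ[ φD ] ≡ main
    card+2φD = begin
      ℚ[ card ] +q ℚ[ φD ] +q ℚ[ φD ]                 ≡⟨ trans (ℚ-+ (card + φD) φD) (cong (_+q ℚ[ φD ]) (ℚ-+ card φD)) ⟨
      ℚ[ card + φD + φD ]                              ≡⟨ cong ℚ[_] cardX-identity ⟩
      ℚ[ phiPowSum A x s * phiPowSum B y t * phi (L * Q) + D s t ] ≡⟨ ℚ-+ (phiPowSum A x s * phiPowSum B y t * phi (L * Q)) (D s t) ⟩
      ℚ[ phiPowSum A x s * phiPowSum B y t * phi (L * Q) ] +q ℚ[ D s t ]
        ≡⟨ cong₂ _+q_ (trans (ℚ-*₃ (phiPowSum A x s) (phiPowSum B y t) (phi (L * Q))) (cong (ℚ[ phiPowSum A x s ] *q ℚ[ phiPowSum B y t ] *q_) ℚ-φR))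
                      (trans (ℚ-*₃ (A ^ (x ∸ s)) (B ^ (y ∸ t)) (L * Q)) (cong (ℚ[ A ^ (x ∸ s) ] *q ℚ[ B ^ (y ∸ t) ] *q_) (ℚ-* L Q))) ⟩
      ℚ[ phiPowSum A x s ] *q ℚ[ phiPowSum B y t ] *q (ℚ[ L ] *q ℚ[ F ]) +q ℚ[ A ^ (x ∸ s) ] *q ℚ[ B ^ (y ∸ t) ] *q (ℚ[ L ] *q ℚ[ Q ]) ∎

  1≤x : 1 ≤ x
  1≤x = ≤-trans 1≤s s≤x
  1≤y : 1 ≤ y
  1≤y = ≤-trans 1≤t t≤y

  U V : ℚ
  U = ℚ[ A ^ (x ∸ 1) ]
  V = ℚ[ B ^ (y ∸ 1) ]

  φn-ℚ : ℚ[ phi N ] ≡ U *q (α -q 1ℚ) *q (V *q (β -q 1ℚ)) *q (ℚ[ L ] *q ℚ[ F ])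
  φn-ℚ = begin
    ℚ[ phi N ]
      ≡⟨ cong ℚ[_] (phi-D 0 0) ⟩
    ℚ[ phi (A ^ x) * phi (B ^ y) * phi (L * Q) ]
      ≡⟨ ℚ-*₃ (phi (A ^ x)) (phi (B ^ y)) (phi (L * Q)) ⟩
    ℚ[ phi (A ^ x) ] *q ℚ[ phi (B ^ y) ] *q ℚ[ phi (L * Q) ]
      ≡⟨ cong₂ (λ a b → a *q b *q ℚ[ phi (L * Q) ]) (ℚ-phi-prime^ A-prime 1≤x) (ℚ-phi-prime^ B-prime 1≤y) ⟩
    U *q (α -q 1ℚ) *q (V *q (β -q 1ℚ)) *q ℚ[ phi (L * Q) ]
      ≡⟨ cong (U *q (α -q 1ℚ) *q (V *q (β -q 1ℚ)) *q_) (trans (cong ℚ[_] phi-LQ) (ℚ-* L F)) ⟩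
    U *q (α -q 1ℚ) *q (V *q (β -q 1ℚ)) *q (ℚ[ L ] *q ℚ[ F ]) ∎
    where open ≡-Reasoning

  n/P-ℚ : frac N P ≡ U *q V *q ℚ[ L ]
  n/P-ℚ = begin
    frac N P                                      ≡⟨ cong (λ m → frac m P) N≡K*P ⟩
    frac (A ^ (x ∸ 1) * B ^ (y ∸ 1) * L * P) P    ≡⟨ frac-exact (A ^ (x ∸ 1) * B ^ (y ∸ 1) * L) P {{m*n≢0 (A * B) Q}} ⟩
    ℚ[ A ^ (x ∸ 1) * B ^ (y ∸ 1) * L ]            ≡⟨ ℚ-*₃ (A ^ (x ∸ 1)) (B ^ (y ∸ 1)) L ⟩
    U *q V *q ℚ[ L ]                              ∎
    where
    open ≡-Reasoning
    rearrange : ∀ a b a′ b′ l q → a * a′ * (b * b′) * (l * q) ≡ a′ * b′ * l * (a * b * q)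
    rearrange = solve-∀
    N≡K*P : N ≡ A ^ (x ∸ 1) * B ^ (y ∸ 1) * L * P
    N≡K*P = trans (cong₂ (λ a b → a * b * (L * Q)) (^-pred A-prime 1≤x) (^-pred B-prime 1≤y))
                  (rearrange A B (A ^ (x ∸ 1)) (B ^ (y ∸ 1)) L Q)

  φab-ℚ : ℚ[ phi (P div (A * B)) ] ≡ ℚ[ F ]
  φab-ℚ = cong (λ m → ℚ[ phi m ]) (trans (cong (_div (A * B)) (*-comm (A * B) Q)) (m*n-div-n Q (A * B)))

  φa-ℚ : ℚ[ phi (P div A) ] ≡ (β -q 1ℚ) *q ℚ[ F ]
  φa-ℚ = begin
    ℚ[ phi (P div A) ]          ≡⟨ cong (λ m → ℚ[ phi (m div A) ]) (rearrange A B Q) ⟩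
    ℚ[ phi ((B * Q * A) div A) ]  ≡⟨ cong (λ m → ℚ[ phi m ]) (m*n-div-n (B * Q) A) ⟩
    ℚ[ phi (B * Q) ]            ≡⟨ cong ℚ[_] (phi-prime-* Q B-prime B∤Q) ⟩
    ℚ[ (B ∸ 1) * F ]            ≡⟨ trans (ℚ-* (B ∸ 1) F) (cong (_*q ℚ[ F ]) (ℚ-∸1 (>-nonZero⁻¹ B))) ⟩
    (β -q 1ℚ) *q ℚ[ F ]         ∎
    where
    open ≡-Reasoning
    rearrange : ∀ a b q → a * b * q ≡ b * q * a
    rearrange = solve-∀

  φb-ℚ : ℚ[ phi (P div B) ] ≡ (α -q 1ℚ) *q ℚ[ F ]
  φb-ℚ = begin
    ℚ[ phi (P div B) ]          ≡⟨ cong (λ m → ℚ[ phi (m div B) ]) (rearrange A B Q) ⟩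
    ℚ[ phi ((A * Q * B) div B) ]  ≡⟨ cong (λ m → ℚ[ phi m ]) (m*n-div-n (A * Q) B) ⟩
    ℚ[ phi (A * Q) ]            ≡⟨ cong ℚ[_] (phi-prime-* Q A-prime A∤Q) ⟩
    ℚ[ (A ∸ 1) * F ]            ≡⟨ trans (ℚ-* (A ∸ 1) F) (cong (_*q ℚ[ F ]) (ℚ-∸1 (>-nonZero⁻¹ A))) ⟩
    (α -q 1ℚ) *q ℚ[ F ]         ∎
    where
    open ≡-Reasoning
    rearrange : ∀ a b q → a * b * q ≡ a * q * b
    rearrange = solve-∀

  2φP-ℚ : ℚ[ 2 * phi P ] ≡ two *q ((α -q 1ℚ) *q ((β -q 1ℚ) *q ℚ[ F ]))
  2φP-ℚ = begin
    ℚ[ 2 * phi P ]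
      ≡⟨ cong (λ m → ℚ[ 2 * phi m ]) (*-assoc A B Q) ⟩
    ℚ[ 2 * phi (A * (B * Q)) ]
      ≡⟨ cong (λ m → ℚ[ 2 * m ]) (phi-prime-* (B * Q) A-prime (∤-* A-prime (∤-prime A-prime B-prime A≢B) A∤Q)) ⟩
    ℚ[ 2 * ((A ∸ 1) * phi (B * Q)) ]
      ≡⟨ cong (λ m → ℚ[ 2 * ((A ∸ 1) * m) ]) (phi-prime-* Q B-prime B∤Q) ⟩
    ℚ[ 2 * ((A ∸ 1) * ((B ∸ 1) * F)) ]
      ≡⟨ trans (ℚ-* 2 ((A ∸ 1) * ((B ∸ 1) * F))) (cong (two *q_) (ℚ-* (A ∸ 1) ((B ∸ 1) * F))) ⟩
    two *q (ℚ[ A ∸ 1 ] *q ℚ[ (B ∸ 1) * F ])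
      ≡⟨ cong₂ (λ a b → two *q (a *q b)) (ℚ-∸1 (>-nonZero⁻¹ A)) (ℚ-* (B ∸ 1) F) ⟩
    two *q ((α -q 1ℚ) *q (ℚ[ B ∸ 1 ] *q ℚ[ F ]))
      ≡⟨ cong (λ b → two *q ((α -q 1ℚ) *q (b *q ℚ[ F ]))) (ℚ-∸1 (>-nonZero⁻¹ B)) ⟩
    two *q ((α -q 1ℚ) *q ((β -q 1ℚ) *q ℚ[ F ])) ∎
    where open ≡-Reasoning

  private
    cardFormula′ : ℚ × ℚ × ℚ → ℚ × ℚ × ℚ → ℚ
    cardFormula′ σa σb = cardFormula σa σb ℚ[ L ] ℚ[ F ] ℚ[ Q ]

  case-≡-≡ : s ≡ x → t ≡ y → ℚ[ cardX N A B s t ] ≡ θ-branches N P A B x y s t true true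
  case-≡-≡ s≡x t≡y = θ-algebra-≡-≡ α β ℚ[ L ] ℚ[ F ] ℚ[ Q ] U V
    (trans card-ℚ (cong₂ cardFormula′ (trans (cong (profile A x) s≡x) (profile-≡ A-prime 1≤x))
                                      (trans (cong (profile B y) t≡y) (profile-≡ B-prime 1≤y))))
    φn-ℚ n/P-ℚ φab-ℚ φa-ℚ φb-ℚ (frac-inverseʳ (A ^ (x ∸ 1))) (frac-inverseʳ (B ^ (y ∸ 1)))
    (frac-*-split 2 (A ^ (x ∸ 1)) (B ^ (y ∸ 1)))
    (begin
      frac P (A ^ x * B ^ y)
        ≡⟨ cong₂ frac (rearrangeP A B Q) (trans (cong₂ _*_ (^-pred A-prime 1≤x) (^-pred B-prime 1≤y)) (rearrange A B (A ^ (x ∸ 1)) (B ^ (y ∸ 1)))) ⟩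
      frac (Q * (A * B)) (A ^ (x ∸ 1) * B ^ (y ∸ 1) * (A * B))
        ≡⟨ frac-*-cancelʳ Q (A ^ (x ∸ 1) * B ^ (y ∸ 1)) (A * B) {{m*n≢0 (A ^ (x ∸ 1)) (B ^ (y ∸ 1))}} ⟩
      frac Q (A ^ (x ∸ 1) * B ^ (y ∸ 1))
        ≡⟨ frac-*-split Q (A ^ (x ∸ 1)) (B ^ (y ∸ 1)) ⟩
      ℚ[ Q ] *q frac 1 (A ^ (x ∸ 1)) *q frac 1 (B ^ (y ∸ 1)) ∎)
    where
    open ≡-Reasoning
    rearrangeP : ∀ a b q → a * b * q ≡ q * (a * b)
    rearrangeP = solve-∀
    rearrange : ∀ a b a′ b′ → a * a′ * (b * b′) ≡ a′ * b′ * (a * b)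
    rearrange = solve-∀

  case-≡-< : s ≡ x → t < y → ℚ[ cardX N A B s t ] ≡ θ-branches N P A B x y s t true false
  case-≡-< s≡x t<y = θ-algebra-≡-< α β ℚ[ L ] ℚ[ F ] ℚ[ Q ] U ℚ[ B ^ t ] ℚ[ B ^ (y ∸ suc t) ]
    (trans card-ℚ (cong₂ cardFormula′ (trans (cong (profile A x) s≡x) (profile-≡ A-prime 1≤x)) (profile-< B-prime t<y)))
    (trans φn-ℚ (cong (λ v → U *q (α -q 1ℚ) *q (v *q (β -q 1ℚ)) *q (ℚ[ L ] *q ℚ[ F ])) (ℚ-^-pred-< B-prime t<y)))
    (trans n/P-ℚ (cong (λ v → U *q v *q ℚ[ L ]) (ℚ-^-pred-< B-prime t<y)))
    φab-ℚ φa-ℚ φb-ℚ (frac-inverseʳ (A ^ (x ∸ 1))) (frac-inverseʳ (B ^ t))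
    (frac-*-split 2 (A ^ (x ∸ 1)) (B ^ t))
    (begin
      frac P (A ^ x * B ^ t)
        ≡⟨ cong₂ frac (rearrangeP A B Q) (trans (cong (_* B ^ t) (^-pred A-prime 1≤x)) (rearrange A (A ^ (x ∸ 1)) (B ^ t))) ⟩
      frac (B * Q * A) (A ^ (x ∸ 1) * B ^ t * A)
        ≡⟨ frac-*-cancelʳ (B * Q) (A ^ (x ∸ 1) * B ^ t) A {{m*n≢0 (A ^ (x ∸ 1)) (B ^ t)}} ⟩
      frac (B * Q) (A ^ (x ∸ 1) * B ^ t)
        ≡⟨ frac-*-split (B * Q) (A ^ (x ∸ 1)) (B ^ t) ⟩
      ℚ[ B * Q ] *q frac 1 (A ^ (x ∸ 1)) *q frac 1 (B ^ t)
        ≡⟨ cong (λ z → z *q frac 1 (A ^ (x ∸ 1)) *q frac 1 (B ^ t)) (ℚ-* B Q) ⟩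
      β *q ℚ[ Q ] *q frac 1 (A ^ (x ∸ 1)) *q frac 1 (B ^ t) ∎)
    where
    open ≡-Reasoning
    rearrangeP : ∀ a b q → a * b * q ≡ b * q * a
    rearrangeP = solve-∀
    rearrange : ∀ a a′ d → a * a′ * d ≡ a′ * d * a
    rearrange = solve-∀

  case-<-≡ : s < x → t ≡ y → ℚ[ cardX N A B s t ] ≡ θ-branches N P A B x y s t false true
  case-<-≡ s<x t≡y = θ-algebra-<-≡ α β ℚ[ L ] ℚ[ F ] ℚ[ Q ] ℚ[ A ^ s ] ℚ[ A ^ (x ∸ suc s) ] V
    (trans card-ℚ (cong₂ cardFormula′ (profile-< A-prime s<x) (trans (cong (profile B y) t≡y) (profile-≡ B-prime 1≤y))))
    (trans φn-ℚ (cong (λ u → u *q (α -q 1ℚ) *q (V *q (β -q 1ℚ)) *q (ℚ[ L ] *q ℚ[ F ])) (ℚ-^-pred-< A-prime s<x)))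
    (trans n/P-ℚ (cong (λ u → u *q V *q ℚ[ L ]) (ℚ-^-pred-< A-prime s<x)))
    φab-ℚ φa-ℚ φb-ℚ (frac-inverseʳ (A ^ s)) (frac-inverseʳ (B ^ (y ∸ 1)))
    (frac-*-split 2 (A ^ s) (B ^ (y ∸ 1)))
    (begin
      frac P (A ^ s * B ^ y)
        ≡⟨ cong₂ frac (rearrangeP A B Q) (trans (cong (A ^ s *_) (^-pred B-prime 1≤y)) (rearrange B (A ^ s) (B ^ (y ∸ 1)))) ⟩
      frac (A * Q * B) (A ^ s * B ^ (y ∸ 1) * B)
        ≡⟨ frac-*-cancelʳ (A * Q) (A ^ s * B ^ (y ∸ 1)) B {{m*n≢0 (A ^ s) (B ^ (y ∸ 1))}} ⟩
      frac (A * Q) (A ^ s * B ^ (y ∸ 1))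
        ≡⟨ frac-*-split (A * Q) (A ^ s) (B ^ (y ∸ 1)) ⟩
      ℚ[ A * Q ] *q frac 1 (A ^ s) *q frac 1 (B ^ (y ∸ 1))
        ≡⟨ cong (λ z → z *q frac 1 (A ^ s) *q frac 1 (B ^ (y ∸ 1))) (ℚ-* A Q) ⟩
      α *q ℚ[ Q ] *q frac 1 (A ^ s) *q frac 1 (B ^ (y ∸ 1)) ∎)
    where
    open ≡-Reasoning
    rearrangeP : ∀ a b q → a * b * q ≡ a * q * b
    rearrangeP = solve-∀
    rearrange : ∀ b c b′ → c * (b * b′) ≡ c * b′ * b
    rearrange = solve-∀

  case-<-< : s < x → t < y → ℚ[ cardX N A B s t ] ≡ θ-branches N P A B x y s t false false
  case-<-< s<x t<y = θ-algebra-<-< α β ℚ[ L ] ℚ[ F ] ℚ[ Q ] ℚ[ A ^ s ] ℚ[ A ^ (x ∸ suc s) ] ℚ[ B ^ t ] ℚ[ B ^ (y ∸ suc t) ]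
    (trans card-ℚ (cong₂ cardFormula′ (profile-< A-prime s<x) (profile-< B-prime t<y)))
    (trans φn-ℚ (cong₂ (λ u v → u *q (α -q 1ℚ) *q (v *q (β -q 1ℚ)) *q (ℚ[ L ] *q ℚ[ F ])) (ℚ-^-pred-< A-prime s<x) (ℚ-^-pred-< B-prime t<y)))
    (trans n/P-ℚ (cong₂ (λ u v → u *q v *q ℚ[ L ]) (ℚ-^-pred-< A-prime s<x) (ℚ-^-pred-< B-prime t<y)))
    φab-ℚ φa-ℚ φb-ℚ (frac-inverseʳ (A ^ s)) (frac-inverseʳ (B ^ t))
    (trans (frac-*-split (2 * phi P) (A ^ s) (B ^ t)) (cong (λ z → z *q frac 1 (A ^ s) *q frac 1 (B ^ t)) 2φP-ℚ))
    (trans (frac-*-split P (A ^ s) (B ^ t)) (cong (λ z → z *q frac 1 (A ^ s) *q frac 1 (B ^ t)) (ℚ-*₃ A B Q)))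

  cardX≡theta : ℚ[ cardX N A B s t ] ≡ theta N P A B x y s t
  cardX≡theta = by-cases (s ≟ x) (t ≟ y)
    where
    select : ∀ {b₁ b₂} → (s ≡ᵇ x) ≡ b₁ → (t ≡ᵇ y) ≡ b₂ → ℚ[ cardX N A B s t ] ≡ θ-branches N P A B x y s t b₁ b₂ →
             ℚ[ cardX N A B s t ] ≡ theta N P A B x y s t
    select refl refl card≡θ = card≡θ
    by-cases : Dec (s ≡ x) → Dec (t ≡ y) → ℚ[ cardX N A B s t ] ≡ theta N P A B x y s t
    by-cases (yes s≡x) (yes t≡y) = select (dec-true (s ≟ x) s≡x) (dec-true (t ≟ y) t≡y) (case-≡-≡ s≡x t≡y)
    by-cases (yes s≡x) (no  t≢y) = select (dec-true (s ≟ x) s≡x) (dec-false (t ≟ y) t≢y) (case-≡-< s≡x (≤∧≢⇒< t≤y t≢y))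
    by-cases (no  s≢x) (yes t≡y) = select (dec-false (s ≟ x) s≢x) (dec-true (t ≟ y) t≡y) (case-<-≡ (≤∧≢⇒< s≤x s≢x) t≡y)
    by-cases (no  s≢x) (no  t≢y) = select (dec-false (s ≟ x) s≢x) (dec-false (t ≟ y) t≢y) (case-<-< (≤∧≢⇒< s≤x s≢x) (≤∧≢⇒< t≤y t≢y))

-- Splitting the product over Fin r

without : ∀ {r} → Fin r → (Fin r → ℕ) → Fin r → ℕ
without a f i = if does (i Fin.≟ a) then 1 else f i

prodF-without : ∀ r (f : Fin r → ℕ) a → prodF r f ≡ f a * prodF r (without a f)
prodF-without (suc r) f Fin.zero    = cong (f Fin.zero *_) (sym (+-identityʳ _))
prodF-without (suc r) f (Fin.suc a) = begin
  f Fin.zero * prodF r (f ∘ Fin.suc)                                       ≡⟨ cong (f Fin.zero *_) (prodF-without r (f ∘ Fin.suc) a) ⟩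
  f Fin.zero * (f (Fin.suc a) * prodF r (without a (f ∘ Fin.suc)))         ≡⟨ swap-left (f Fin.zero) (f (Fin.suc a)) _ ⟩
  f (Fin.suc a) * (f Fin.zero * prodF r (without a (f ∘ Fin.suc)))         ∎
  where
  open ≡-Reasoning
  swap-left : ∀ l m n → l * (m * n) ≡ m * (l * n)
  swap-left = solve-∀

prodF-cong : ∀ r {f g : Fin r → ℕ} → (∀ i → f i ≡ g i) → prodF r f ≡ prodF r g
prodF-cong zero    f≗g = refl
prodF-cong (suc r) f≗g = cong₂ _*_ (f≗g Fin.zero) (prodF-cong r (f≗g ∘ Fin.suc))

prodF-* : ∀ r (f g : Fin r → ℕ) → prodF r (λ i → f i * g i) ≡ prodF r f * prodF r g
prodF-* zero    f g = refl
prodF-* (suc r) f g = trans (cong (f Fin.zero * g Fin.zero *_) (prodF-* r (f ∘ Fin.suc) (g ∘ Fin.suc)))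
                            (interchange′ (f Fin.zero) (g Fin.zero) _ _)
  where
  interchange′ : ∀ a b c d → a * b * (c * d) ≡ a * c * (b * d)
  interchange′ = solve-∀

module _ (P : ℕ → Set) (P-1 : P 1) (P-* : ∀ {m n} → P m → P n → P (m * n)) where

  prodF-closed : ∀ r (f : Fin r → ℕ) → (∀ i → P (f i)) → P (prodF r f)
  prodF-closed zero    f Pf = P-1
  prodF-closed (suc r) f Pf = P-* (Pf Fin.zero) (prodF-closed r (f ∘ Fin.suc) (Pf ∘ Fin.suc))

coprime-prodF⁻ : ∀ {k} r (f : Fin r → ℕ) → Coprime k (prodF r f) → ∀ i → Coprime k (f i)
coprime-prodF⁻ (suc r) f k⊥∏ Fin.zero    = coprime-*⁻ˡ k⊥∏
coprime-prodF⁻ (suc r) f k⊥∏ (Fin.suc i) = coprime-prodF⁻ r (f ∘ Fin.suc) (coprime-*⁻ʳ {m = f Fin.zero} k⊥∏) i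

module Decomposition {r : ℕ} (p e : Fin r → ℕ) (p-prime : ∀ i → Prime (p i)) (p-injective : ∀ i j → p i ≡ p j → i ≡ j)
                     (e≥1 : ∀ i → 1 ≤ e i) {a b : Fin r} (a≢b : a ≢ b) where

  others : (Fin r → ℕ) → Fin r → ℕ
  others f = without b (without a f)

  others-cong : ∀ {f g} → (∀ i → f i ≡ g i) → ∀ i → others f i ≡ others g i
  others-cong f≗g i with i Fin.≟ a | i Fin.≟ b
  ... | _     | yes _ = refl
  ... | yes _ | no  _ = refl
  ... | no  _ | no  _ = f≗g i

  others-* : ∀ f g i → others (λ j → f j * g j) i ≡ others f i * others g i
  others-* f g i with i Fin.≟ a | i Fin.≟ b
  ... | _     | yes _ = refl
  ... | yes _ | no  _ = refl
  ... | no  _ | no  _ = refl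

  L Q : ℕ
  L = prodF r (others (λ i → p i ^ (e i ∸ 1)))
  Q = prodF r (others p)

  prodF-split : ∀ f → prodF r f ≡ f a * f b * prodF r (others f)
  prodF-split f = begin
    prodF r f                                              ≡⟨ prodF-without r f a ⟩
    f a * prodF r (without a f)                            ≡⟨ cong (f a *_) (prodF-without r (without a f) b) ⟩
    f a * (without a f b * prodF r (others f))             ≡⟨ cong (λ m → f a * (m * prodF r (others f))) without-a-b ⟩
    f a * (f b * prodF r (others f))                       ≡⟨ *-assoc (f a) (f b) _ ⟨
    f a * f b * prodF r (others f)                         ∎
    where
    open ≡-Reasoning
    without-a-b : without a f b ≡ f b
    without-a-b with b Fin.≟ a
    ... | yes b≡a = contradiction (sym b≡a) a≢b
    ... | no  _   = refl

  prodF-others : prodF r (others (λ i → p i ^ e i)) ≡ L * Q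
  prodF-others = begin
    prodF r (others (λ i → p i ^ e i))                                   ≡⟨ prodF-cong r (others-cong (λ i → ^-pred′ (p i) (e≥1 i))) ⟩
    prodF r (others (λ i → p i ^ (e i ∸ 1) * p i))                       ≡⟨ prodF-cong r (others-* (λ i → p i ^ (e i ∸ 1)) p) ⟩
    prodF r (λ i → others (λ i → p i ^ (e i ∸ 1)) i * others p i)        ≡⟨ prodF-* r _ _ ⟩
    L * Q                                                                ∎
    where
    open ≡-Reasoning
    ^-pred′ : ∀ m {k} → 1 ≤ k → m ^ k ≡ m ^ (k ∸ 1) * m
    ^-pred′ m {suc k} _ = *-comm m (m ^ k)

  n≡ : prodF r (λ i → p i ^ e i) ≡ p a ^ e a * p b ^ e b * (L * Q)
  n≡ = trans (prodF-split (λ i → p i ^ e i)) (cong (p a ^ e a * p b ^ e b *_) prodF-others)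

  P≡ : prodF r p ≡ p a * p b * Q
  P≡ = prodF-split p

  pa≢pb : p a ≢ p b
  pa≢pb pa≡pb = a≢b (p-injective a b pa≡pb)

  ∤LQ : ∀ {c} → c ≡ a ⊎ c ≡ b → ¬ p c ∣ L * Q
  ∤LQ {c} c∈ab = subst (λ m → ¬ p c ∣ m) prodF-others
    (prodF-closed (λ m → ¬ p c ∣ m) (∤1 (p-prime c)) (∤-* (p-prime c)) r _ ∤-others)
    where
    ∤-others : ∀ i → ¬ p c ∣ others (λ i → p i ^ e i) i
    ∤-others i with i Fin.≟ a | i Fin.≟ b
    ... | _      | yes _  = ∤1 (p-prime c)
    ... | yes _  | no  _  = ∤1 (p-prime c)
    ... | no i≢a | no i≢b = ∤-^ (p-prime c) (e i) (∤-prime (p-prime c) (p-prime i) (c≢i ∘ p-injective c i))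
      where
      c≢i : c ≢ i
      c≢i c≡i = [ (λ c≡a → i≢a (trans (sym c≡i) c≡a)) , (λ c≡b → i≢b (trans (sym c≡i) c≡b)) ] c∈ab

  coprime-Q⇒coprime-L : ∀ {k} → Coprime k Q → Coprime k L
  coprime-Q⇒coprime-L {k} k⊥Q = prodF-closed (Coprime k) k⊥1 coprime-* r _ (λ i → coprime-others i (coprime-prodF⁻ r (others p) k⊥Q i))
    where
    k⊥1 : Coprime k 1
    k⊥1 (_ , d∣1) = ∣1⇒≡1 d∣1
    coprime-others : ∀ i → Coprime k (others p i) → Coprime k (others (λ i → p i ^ (e i ∸ 1)) i)
    coprime-others i with i Fin.≟ a | i Fin.≟ b
    ... | _     | yes _ = λ _ → k⊥1
    ... | yes _ | no  _ = λ _ → k⊥1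
    ... | no  _ | no  _ = coprime-^ (e i ∸ 1)

strictMono⇒injective : ∀ {r} (p : Fin r → ℕ) → (∀ i j → i Fin.< j → p i < p j) → ∀ i j → p i ≡ p j → i ≡ j
strictMono⇒injective p mono i j pi≡pj with Finₚ.<-cmp i j
... | tri< i<j _ _ = contradiction pi≡pj (<⇒≢ (mono i j i<j))
... | tri≈ _ i≡j _ = i≡j
... | tri> _ _ j<i = contradiction (sym pi≡pj) (<⇒≢ (mono j i j<i))

proposition4p1 : (r : ℕ) → 3 ≤ r →
    (p : Fin r → ℕ) → (∀ i → Prime (p i)) → (∀ i j → i Fin.< j → p i < p j) →
    (e : Fin r → ℕ) → (∀ i → 1 ≤ e i) →
    (a b : Fin r) → a ≢ b →
    (s t : ℕ) → 1 ≤ s → s ≤ e a → 1 ≤ t → t ≤ e b →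
    let n = prodF r (λ i → p i Data.Nat.^ e i)
        P = prodF r p
    in ℚ[ cardX n (p a) (p b) s t ] ≡ theta n P (p a) (p b) (e a) (e b) s t
proposition4p1 r _ p p-prime p-mono e e≥1 a b a≢b s t 1≤s s≤ea 1≤t t≤eb =
  subst₂ (λ n P → ℚ[ cardX n (p a) (p b) s t ] ≡ theta n P (p a) (p b) (e a) (e b) s t) (sym n≡) (sym P≡)
    (CardXTheta.cardX≡theta (p-prime a) (p-prime b) pa≢pb 1≤s s≤ea 1≤t t≤eb (∤LQ (inj₁ refl)) (∤LQ (inj₂ refl)) coprime-Q⇒coprime-L)
  where open Decomposition p e p-prime (strictMono⇒injective p p-mono) e≥1 a≢b
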